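{- Let $p_1\equiv 7\pmod 8$ be a prime, $m\ge1$, $N=2p_1^m$, and let $p\equiv 3\pmod 4$ be a prime with $f:=\mathrm{ord}_N(p)=\phi(N)/2$. Let $s$ be odd, $q=p^{fs}$, and let $I\subseteq\mathbb{Z}/N\mathbb{Z}$ satisfy $\{i \bmod p_1^m: i\in I\}=\mathbb{Z}/p_1^m\mathbb{Z}$. Let $t$ be an odd prime with $\gcd(t,p_1)=1$, let $\gamma$ be a primitive element of $\mathbb{F}_{q^t}$ and $\omega=\gamma^{(q^t-1)/(q-1)}$ (a primitive element of $\mathbb{F}_q$). Let $D=\bigcup_{i\in I}\omega^i\langle\omega^N\rangle\subseteq\mathbb{F}_q$ and let $D'=\bigcup_{i\in I}\gamma^i\langle\gamma^N\rangle\subseteq\mathbb{F}_{q^t}$ be its lift. Let $t^{ -1}$ denote the inverse of $t$ modulo $N$ and $D^{(t^{ -1})}=\bigcup_{i\in I}\omega^{t^{ -1}i}\langle\omega^N\rangle$. Fix $a\in\mathbb{F}_p^\ast\setminus\{1\}$. If the set $\{T_{\omega^\ell,a}(D^{(t^{ -1})}) \bmod t : 0\le\ell\le N-1\}$ contains $u$ distinct elements, then the set $\{T_{\gamma^\ell,a}(D')\bmod t: 0\le \ell\le N-1\}$ also contains $u$ distinct elements.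
   Context: For a subset $E$ of a finite field $\mathbb{F}$ of characteristic $p$, an element $x\in\mathbb{F}^\ast$, and $a\in\mathbb{F}_p^\ast\setminus\{1\}$, the triple intersection number is $T_{x,a}(E)=|E\cap(E-x)\cap(E-ax)|$, where $E-y=\{e-y:e\in E\}$. Here $\langle\omega^N\rangle$ is the multiplicative subgroup generated by $\omega^N$, and $\omega^i\langle\omega^N\rangle$ its coset. (Under these hypotheses $D$ and $D'$ are skew Hadamard difference sets, i.e. difference sets with $G=D\sqcup(-D)\sqcup\{0\}$.) -}

module Defs where

open import Level using (0ℓ)
open import Data.Nat using (ℕ; zero; suc; _∸_; _^_; _≤_; _<_)
open import Data.Nat as ℕ using ()
open import Data.Nat.Divisibility using (_∣_)
open import Data.Nat.GCD using (gcd)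
open import Data.Nat.Properties using (_≟_)
open import Data.Fin using (Fin; toℕ)
open import Data.Fin.Subset using (Subset; _∈_)
open import Data.List using (List; length; filter; upTo; map; deduplicate)
open import Data.Product using (Σ; ∃; _×_)
open import Relation.Binary.PropositionalEquality using (_≡_; _≢_)
open import Relation.Nullary using (¬_)
open import Function.Bundles using (_↔_)
open import Function.Definitions using (Injective)
open import Algebra.Core using (Op₁; Op₂)
import Algebra.Structures

_≡_[mod_] : ℕ → ℕ → ℕ → Set
x ≡ y [mod n ] = (n ∣ (x ∸ y)) × (n ∣ (y ∸ x))

-- Euler's totient: #{ 0 ≤ k < n : gcd(k,n) = 1 } (agrees with φ(n) for n ≥ 1).
φ : ℕ → ℕ
φ n = length (filter (λ k → gcd k n ≟ 1) (upTo n))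

IsOrd : (N a f : ℕ) → Set
IsOrd N a f = (1 ≤ f) × ((a ^ f) ≡ 1 [mod N ]) ×
              (∀ j → 1 ≤ j → j < f → ¬ ((a ^ j) ≡ 1 [mod N ]))

#distinct : List ℕ → ℕ
#distinct xs = length (deduplicate _≟_ xs)

record FiniteField : Set₁ where
  field
    Carrier : Set
    _+_ : Op₂ Carrier
    _*_ : Op₂ Carrier
    -_  : Op₁ Carrier
    0#  : Carrier
    1#  : Carrier
    isCommutativeRing : Algebra.Structures.IsCommutativeRing {A = Carrier} _≡_ _+_ _*_ -_ 0# 1#
    0≢1 : 0# ≢ 1#
    inverse : ∀ x → x ≢ 0# → ∃ λ y → (x * y) ≡ 1#
    size : ℕ
    enum : Fin size ↔ Carrier
  infixl 7 _*_
  infixl 6 _+_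

  _^'_ : Carrier → ℕ → Carrier
  x ^' zero = 1#
  x ^' suc n = x * (x ^' n)

  ι : ℕ → Carrier
  ι zero = 0#
  ι (suc n) = 1# + ι n

  Primitive : Carrier → Set
  Primitive γ = ∀ x → x ≢ 0# → ∃ λ e → x ≡ γ ^' e

  -- ⋃_{i ∈ I} g^{c·i} ⟨g^N⟩  (c = 1 gives ⋃_{i∈I} g^i⟨g^N⟩)
  CosetUnion : (g : Carrier) (N : ℕ) (I : Subset N) (c : ℕ) → Carrier → Set
  CosetUnion g N I c y =
    Σ (Fin N) λ i → (i ∈ I) × ∃ λ k → y ≡ g ^' (c ℕ.* toℕ i ℕ.+ N ℕ.* k)

  TripleSet : (Carrier → Set) → Carrier → Carrier → Carrier → Set
  TripleSet E x a y = E y × E (y + x) × E (y + (a * x))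

  HasCard : (Carrier → Set) → ℕ → Set
  HasCard P n = Σ (Fin n → Carrier) λ h → Injective _≡_ _≡_ h ×
                  (∀ y → (P y → ∃ λ j → h j ≡ y) × (∀ j → P (h j)))

module Submission where

-- Let L = F_{q^t}, σ(y) = y^q the Frobenius and γ primitive in L.  Since
-- q ≡ 1 (mod N), the lift D′ = ⋃_{i∈I} γ^i⟨γ^N⟩ is σ-stable; since
-- ω = γ^e₀ with e₀ = 1 + q + … + q^(t-1) ≡ t (mod N), the σ-fixed points of
-- D′ are exactly D^(t⁻¹) = ⋃_{i∈I} ω^(t⁻¹ i)⟨ω^N⟩.  For x, a fixed by σ, σ
-- permutes S = D′ ∩ (D′ - x) ∩ (D′ - a x), and as σ^t = id with t prime the
-- points of S not fixed by σ form orbits of size t; hence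
-- |S| ≡ |S^σ| = T_{x,a}(D^(t⁻¹)) (mod t).  Finally D′ is stable under γ^N, so
-- T_{γ^ℓ,a}(D′) ≡ T_{ω^(t⁻¹ℓ),a}(D^(t⁻¹)) (mod t), and ℓ ↦ t⁻¹ℓ permutes ℤ/N:
-- both lists of residues have the same set of values.  Only q ≡ 1 (mod N),
-- q ≥ 3, t prime and the characteristic are used from the hypotheses.

open import Data.Nat using (ℕ; NonZero)

module Cardinality where

  open import Data.Nat using (ℕ; zero; suc; _+_; _≤_)
  open import Data.Nat.Properties using (≤-antisym; +-suc)
  open import Data.Fin using (Fin; zero; suc)
  open import Data.Fin.Properties using (injective⇒≤; suc-injective)
  open import Data.Product using (Σ; ∃; _×_; _,_; proj₁; proj₂)
  open import Data.Empty using (⊥-elim)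
  open import Relation.Nullary using (¬_; Dec; yes; no)
  open import Relation.Binary.PropositionalEquality
  open import Function.Definitions using (Injective)

  Card : {A : Set} → (A → Set) → ℕ → Set
  Card {A} P n = Σ (Fin n → A) λ h → Injective _≡_ _≡_ h ×
                   (∀ y → (P y → ∃ λ j → h j ≡ y) × (∀ j → P (h j)))

  module _ {A : Set} {P : A → Set} where

    card : ∀ {n} (h : Fin n → A) → Injective _≡_ _≡_ h →
           (∀ y → P y → ∃ λ j → h j ≡ y) → (∀ j → P (h j)) → Card P n
    card h inj cov mem = h , inj , λ y → cov y , mem

    enumerate : ∀ {n} → Card P n → Fin n → A
    enumerate = proj₁

    enumerate-injective : ∀ {n} (C : Card P n) → Injective _≡_ _≡_ (enumerate C)
    enumerate-injective C = proj₁ (proj₂ C)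

    enumerate-sound : ∀ {n} (C : Card P n) → ∀ j → P (enumerate C j)
    enumerate-sound (h , _ , c) j = proj₂ (c (h j)) j

    enumerate-complete : ∀ {n} (C : Card P n) → ∀ y → P y → ∃ λ j → enumerate C j ≡ y
    enumerate-complete (_ , _ , c) y py = proj₁ (c y) py

    -- One enumeration of a set injects into any other one ...
    card-≤ : ∀ {n m} → Card P n → Card P m → n ≤ m
    card-≤ {n} {m} C C′ = injective⇒≤ {f = f} f-injective
      where
      f : Fin n → Fin m
      f i = proj₁ (enumerate-complete C′ _ (enumerate-sound C i))
      f-correct : ∀ i → enumerate C′ (f i) ≡ enumerate C i
      f-correct i = proj₂ (enumerate-complete C′ _ (enumerate-sound C i))
      f-injective : Injective _≡_ _≡_ f
      f-injective {i} {j} e = enumerate-injective C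
        (trans (sym (f-correct i)) (trans (cong (enumerate C′) e) (f-correct j)))

    card-unique : ∀ {n m} → Card P n → Card P m → n ≡ m
    card-unique C C′ = ≤-antisym (card-≤ C C′) (card-≤ C′ C)

  card-cong : ∀ {A : Set} {P Q : A → Set} {n} →
              (∀ y → P y → Q y) → (∀ y → Q y → P y) → Card P n → Card Q n
  card-cong P⇒Q Q⇒P C = card (enumerate C) (enumerate-injective C)
    (λ y q → enumerate-complete C y (Q⇒P y q)) (λ j → P⇒Q _ (enumerate-sound C j))

  card-unique′ : ∀ {A : Set} {P Q : A → Set} {n m} →
                 (∀ y → P y → Q y) → (∀ y → Q y → P y) → Card P n → Card Q m → n ≡ m
  card-unique′ P⇒Q Q⇒P C = card-unique (card-cong P⇒Q Q⇒P C)

  module _ {n : ℕ} (Q : Fin (suc n) → Set) where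

    card-with-zero : ∀ {a} → Q zero → Card (λ i → Q (suc i)) a → Card Q (suc a)
    card-with-zero {a} q0 C = card h h-injective h-complete h-sound
      where
      h : Fin (suc a) → Fin (suc n)
      h zero = zero
      h (suc j) = suc (enumerate C j)
      h-injective : Injective _≡_ _≡_ h
      h-injective {zero} {zero} _ = refl
      h-injective {suc i} {suc j} e = cong suc (enumerate-injective C (suc-injective e))
      h-injective {zero} {suc j} ()
      h-injective {suc i} {zero} ()
      h-complete : ∀ y → Q y → ∃ λ j → h j ≡ y
      h-complete zero _ = zero , refl
      h-complete (suc y) qy with enumerate-complete C y qy
      ... | j , e = suc j , cong suc e
      h-sound : ∀ j → Q (h j)
      h-sound zero = q0
      h-sound (suc j) = enumerate-sound C j

    card-without-zero : ∀ {a} → ¬ Q zero → Card (λ i → Q (suc i)) a → Card Q a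
    card-without-zero nq0 C = card (λ j → suc (enumerate C j))
      (λ e → enumerate-injective C (suc-injective e)) h-complete (enumerate-sound C)
      where
      h-complete : ∀ y → Q y → ∃ λ j → suc (enumerate C j) ≡ y
      h-complete zero q = ⊥-elim (nq0 q)
      h-complete (suc y) qy with enumerate-complete C y qy
      ... | j , e = j , cong suc e

  fin-split : ∀ n (D : Fin n → Set) → (∀ i → Dec (D i)) →
              Σ ℕ λ a → Σ ℕ λ b → (n ≡ a + b) × Card D a × Card (λ i → ¬ D i) b
  fin-split zero D dec = 0 , 0 , refl , card (λ ()) (λ {}) (λ ()) (λ ()) , card (λ ()) (λ {}) (λ ()) (λ ())
  fin-split (suc n) D dec with fin-split n (λ i → D (suc i)) (λ i → dec (suc i)) | dec zero
  ... | a , b , e , C , C′ | yes d0 =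
    suc a , b , cong suc e , card-with-zero D d0 C , card-without-zero (λ i → ¬ D i) (λ nd → nd d0) C′
  ... | a , b , e , C , C′ | no nd0 =
    a , suc b , trans (cong suc e) (sym (+-suc a b)) , card-without-zero D nd0 C , card-with-zero (λ i → ¬ D i) nd0 C′

  card-split : ∀ {A : Set} {P : A → Set} (Q : A → Set) → (∀ y → Dec (Q y)) → ∀ {n} → Card P n →
               Σ ℕ λ a → Σ ℕ λ b → (n ≡ a + b) × Card (λ y → P y × Q y) a × Card (λ y → P y × ¬ Q y) b
  card-split {A} {P} Q dec {n} C with fin-split n (λ i → Q (enumerate C i)) (λ i → dec (enumerate C i))
  ... | a , b , e , S , S′ = a , b , e , restrict Q S , restrict (λ y → ¬ Q y) S′
    where
    h = enumerate C
    restrict : ∀ (R : A → Set) {c} → Card (λ i → R (h i)) c → Card (λ y → P y × R y) c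
    restrict R S = card (λ j → h (enumerate S j))
      (λ x → enumerate-injective S (enumerate-injective C x))
      (λ y (py , ry) → let (i , ei) = enumerate-complete C y py
                           (j , ej) = enumerate-complete S i (subst R (sym ei) ry)
                       in j , trans (cong h ej) ei)
      (λ j → enumerate-sound C _ , enumerate-sound S j)

module Congruence (N : ℕ) {{_ : NonZero N}} where

  open import Defs using (_≡_[mod_])
  open import Data.Nat using (zero; suc; _+_; _*_; _∸_; _^_; _≤_; _%_; _/_)
  open import Data.Nat.Properties
  open import Data.Nat.DivMod
  open import Data.Nat.Divisibility using (_∣_; divides)
  open import Data.Sum using (inj₁; inj₂)
  open import Data.Product using (_,_)
  open import Relation.Binary.PropositionalEquality
  open ≡-Reasoning

  infix 4 _≋_
  _≋_ : ℕ → ℕ → Set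
  a ≋ b = a % N ≡ b % N

  ≋-+ : ∀ {a b c d} → a ≋ b → c ≋ d → a + c ≋ b + d
  ≋-+ {a} {b} {c} {d} e₁ e₂ = begin
    (a + c) % N             ≡⟨ %-distribˡ-+ a c N ⟩
    (a % N + c % N) % N     ≡⟨ cong₂ (λ x y → (x + y) % N) e₁ e₂ ⟩
    (b % N + d % N) % N     ≡⟨ %-distribˡ-+ b d N ⟨
    (b + d) % N             ∎

  ≋-* : ∀ {a b c d} → a ≋ b → c ≋ d → a * c ≋ b * d
  ≋-* {a} {b} {c} {d} e₁ e₂ = begin
    (a * c) % N             ≡⟨ %-distribˡ-* a c N ⟩
    (a % N * (c % N)) % N   ≡⟨ cong₂ (λ x y → (x * y) % N) e₁ e₂ ⟩
    (b % N * (d % N)) % N   ≡⟨ %-distribˡ-* b d N ⟨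
    (b * d) % N             ∎

  ≋-^ : ∀ {a} → a ≋ 1 → ∀ n → a ^ n ≋ 1
  ≋-^ e zero = refl
  ≋-^ e (suc n) = ≋-* e (≋-^ e n)

  %-≋ : ∀ a → a % N ≋ a
  %-≋ a = m%n%n≡m%n a N

  multiple-≋ : ∀ a k → a + N * k ≋ a
  multiple-≋ a k = begin
    (a + N * k) % N ≡⟨ cong (λ z → (a + z) % N) (*-comm N k) ⟩
    (a + k * N) % N ≡⟨ [m+kn]%n≡m%n a k N ⟩
    a % N           ∎

  ∣⇒≋0 : ∀ {a} → N ∣ a → a ≋ 0
  ∣⇒≋0 (divides k refl) = trans (m*n%n≡0 k N) (sym (m*n%n≡0 0 N))

  ≋⇒∣∸ : ∀ {a b} → a ≋ b → b ≤ a → N ∣ a ∸ b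
  ≋⇒∣∸ {a} {b} e b≤a = divides (a / N ∸ b / N) (begin
    a ∸ b                                      ≡⟨ cong₂ _∸_ (m≡m%n+[m/n]*n a N) (m≡m%n+[m/n]*n b N) ⟩
    (a % N + a / N * N) ∸ (b % N + b / N * N)  ≡⟨ cong (λ z → (z + a / N * N) ∸ (b % N + b / N * N)) e ⟩
    (b % N + a / N * N) ∸ (b % N + b / N * N)  ≡⟨ [m+n]∸[m+o]≡n∸o (b % N) (a / N * N) (b / N * N) ⟩
    a / N * N ∸ b / N * N                      ≡⟨ *-distribʳ-∸ N (a / N) (b / N) ⟨
    (a / N ∸ b / N) * N                        ∎)

  ∣∸⇒≋ : ∀ {a b} → b ≤ a → N ∣ a ∸ b → a ≋ b
  ∣∸⇒≋ {a} {b} b≤a (divides k e) = begin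
    a % N              ≡⟨ cong (_% N) (m+[n∸m]≡n b≤a) ⟨
    (b + (a ∸ b)) % N  ≡⟨ cong (λ z → (b + z) % N) e ⟩
    (b + k * N) % N    ≡⟨ [m+kn]%n≡m%n b k N ⟩
    b % N              ∎

  mod⇒≋ : ∀ {a b} → a ≡ b [mod N ] → a ≋ b
  mod⇒≋ {a} {b} (N∣a∸b , N∣b∸a) with ≤-total b a
  ... | inj₁ b≤a = ∣∸⇒≋ b≤a N∣a∸b
  ... | inj₂ a≤b = sym (∣∸⇒≋ a≤b N∣b∸a)

module Orbits where

  open Cardinality
  open import Data.Nat using (ℕ; zero; suc; _+_; _*_; _∸_; _≤_; _<_; s≤s; z≤n; _%_; _/_; NonZero; >-nonZero⁻¹)
  open import Data.Nat.Properties
  open import Data.Nat.DivMod using (m≡m%n+[m/n]*n; m%n<n)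
  open import Data.Nat.Primality using (Prime)
  open import Data.Nat.Coprimality using (prime⇒coprime; coprime-Bézout)
  open import Data.Nat.GCD using (module Bézout)
  open import Data.Fin using (Fin; toℕ; fromℕ<; combine; remQuot)
  open import Data.Fin.Properties using (all?; toℕ-injective; toℕ-fromℕ<; remQuot-combine; combine-remQuot; toℕ<n)
  open import Data.Product using (∃; _×_; _,_; proj₁; proj₂; uncurry)
  open import Data.Sum using ([_,_]′)
  open import Data.Empty using (⊥-elim)
  open import Relation.Nullary using (¬_; Dec; yes; no)
  open import Relation.Binary.PropositionalEquality
  open import Relation.Binary.Definitions using (tri<; tri≈; tri>)
  open import Function.Definitions using (Injective)

  module Iteration {A : Set} (σ : A → A) where

    iter : ℕ → A → A
    iter zero y = y
    iter (suc n) y = σ (iter n y)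

    iter-+ : ∀ m n y → iter (m + n) y ≡ iter m (iter n y)
    iter-+ zero n y = refl
    iter-+ (suc m) n y = cong σ (iter-+ m n y)

    iter-periodic : ∀ d y → iter d y ≡ y → ∀ k → iter (k * d) y ≡ y
    iter-periodic d y e zero = refl
    iter-periodic d y e (suc k) =
      trans (iter-+ d (k * d) y) (trans (cong (iter d) (iter-periodic d y e k)) e)

    iter-fixed : ∀ y → σ y ≡ y → ∀ m → iter m y ≡ y
    iter-fixed y e zero = refl
    iter-fixed y e (suc m) = trans (cong σ (iter-fixed y e m)) e

    iter-stable : (P : A → Set) → (∀ y → P y → P (σ y)) → ∀ m y → P y → P (iter m y)
    iter-stable P stable zero y py = py
    iter-stable P stable (suc m) y py = stable _ (iter-stable P stable m y py)

  argmin : (f : ℕ → ℕ) → ∀ t → 0 < t → ∃ λ j → j < t × (∀ m → m < t → f j ≤ f m)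
  argmin f (suc zero) _ = 0 , s≤s z≤n , λ { zero _ → ≤-refl ; (suc m) (s≤s ()) }
  argmin f (suc (suc t)) _ with argmin f (suc t) (s≤s z≤n)
  ... | j , j<t , j-min with f j ≤? f (suc t)
  ... | yes fj≤ = j , m<n⇒m<1+n j<t , λ m m< → [ j-min m , (λ { refl → fj≤ }) ]′ (m<1+n⇒m<n∨m≡n m<)
  ... | no fj≰ = suc t , ≤-refl , λ m m< →
    [ (λ m<′ → ≤-trans (<⇒≤ (≰⇒> fj≰)) (j-min m m<′)) , (λ { refl → ≤-refl }) ]′ (m<1+n⇒m<n∨m≡n m<)

  -- Counting modulo a prime period: if σ^t = id with t prime, every σ-stable
  -- finite set P satisfies |P| ≡ |P ∩ Fix σ| (mod t), since the points not
  -- fixed by σ fall into orbits of size exactly t.  Orbits are counted through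
  -- their representatives of least index under an injection idx : A → ℕ.
  module PrimePeriod {A : Set} (_≟_ : ∀ (x y : A) → Dec (x ≡ y))
    (idx : A → ℕ) (idx-injective : ∀ x y → idx x ≡ idx y → x ≡ y)
    (σ : A → A) (t : ℕ) .{{_ : NonZero t}} (t-prime : Prime t)
    (σ^t≡id : ∀ y → Iteration.iter σ t y ≡ y) where

    open Iteration σ

    Fixed : A → Set
    Fixed y = σ y ≡ y

    iter-mod : ∀ m y → iter m y ≡ iter (m % t) y
    iter-mod m y = begin
      iter m y                        ≡⟨ cong (λ z → iter z y) (m≡m%n+[m/n]*n m t) ⟩
      iter (m % t + (m / t) * t) y    ≡⟨ iter-+ (m % t) _ y ⟩
      iter (m % t) (iter ((m / t) * t) y) ≡⟨ cong (iter (m % t)) (iter-periodic t y (σ^t≡id y) (m / t)) ⟩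
      iter (m % t) y                  ∎
      where open ≡-Reasoning

    iter-undo : ∀ j y → j ≤ t → iter (t ∸ j) (iter j y) ≡ y
    iter-undo j y j≤t =
      trans (sym (iter-+ (t ∸ j) j y)) (trans (cong (λ z → iter z y) (m∸n+n≡m j≤t)) (σ^t≡id y))

    -- A period 0 < d < t forces a fixed point, since gcd(d, t) = 1 (Bézout).
    period⇒fixed : ∀ d y → 0 < d → d < t → iter d y ≡ y → Fixed y
    period⇒fixed d@(suc _) y _ d<t σ^d≡id with coprime-Bézout (prime⇒coprime t-prime d<t)
    ... | Bézout.+- x v eq = begin
      σ y               ≡⟨ cong σ (iter-periodic d y σ^d≡id v) ⟨
      iter (1 + v * d) y ≡⟨ cong (λ z → iter z y) eq ⟩
      iter (x * t) y    ≡⟨ iter-periodic t y (σ^t≡id y) x ⟩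
      y                 ∎
      where open ≡-Reasoning
    ... | Bézout.-+ x v eq = begin
      σ y               ≡⟨ cong σ (iter-periodic t y (σ^t≡id y) x) ⟨
      iter (1 + x * t) y ≡⟨ cong (λ z → iter z y) eq ⟩
      iter (v * d) y    ≡⟨ iter-periodic d y σ^d≡id v ⟩
      y                 ∎
      where open ≡-Reasoning

    free-orbit-injective : ∀ y → ¬ Fixed y → ∀ j j′ → j < j′ → j′ < t → iter j y ≢ iter j′ y
    free-orbit-injective y not-fixed j j′ j<j′ j′<t e = not-fixed (period⇒fixed (t ∸ j′ + j) y 0<d d<t σ^d≡id)
      where
      σ^d≡id : iter (t ∸ j′ + j) y ≡ y
      σ^d≡id = trans (iter-+ (t ∸ j′) j y) (trans (cong (iter (t ∸ j′)) e) (iter-undo j′ y (<⇒≤ j′<t)))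
      0<d : 0 < t ∸ j′ + j
      0<d = ≤-trans (m<n⇒0<n∸m j′<t) (m≤m+n _ _)
      d<t : t ∸ j′ + j < t
      d<t = begin-strict
        t ∸ j′ + j   <⟨ +-monoʳ-< (t ∸ j′) j<j′ ⟩
        t ∸ j′ + j′  ≡⟨ m∸n+n≡m (<⇒≤ j′<t) ⟩
        t            ∎
        where open ≤-Reasoning

    free-stable : ∀ m y → ¬ Fixed y → ¬ Fixed (iter m y)
    free-stable m y not-fixed fixed = not-fixed (subst Fixed (sym back) fixed)
      where
      back : y ≡ iter m y
      back = begin
        y                                  ≡⟨ iter-undo (m % t) y (<⇒≤ (m%n<n m t)) ⟨
        iter (t ∸ m % t) (iter (m % t) y)  ≡⟨ cong (iter (t ∸ m % t)) (iter-mod m y) ⟨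
        iter (t ∸ m % t) (iter m y)        ≡⟨ iter-fixed _ fixed (t ∸ m % t) ⟩
        iter m y                           ∎
        where open ≡-Reasoning

    IsRep : A → Set
    IsRep y = ∀ (j : Fin t) → idx y ≤ idx (iter (toℕ j) y)

    isRep? : ∀ y → Dec (IsRep y)
    isRep? y = all? (λ j → idx y ≤? idx (iter (toℕ j) y))

    -- b lies in the orbit of a, so a representative a has index at most idx b.
    rep-least : ∀ a b (j j′ : Fin t) → iter (toℕ j) a ≡ iter (toℕ j′) b → IsRep a → idx a ≤ idx b
    rep-least a b j j′ e a-rep = subst (λ z → idx a ≤ idx z) (sym b≡) (a-rep i)
      where
      d = t ∸ toℕ j′ + toℕ j
      i = fromℕ< (m%n<n d t)
      b≡ : b ≡ iter (toℕ i) a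
      b≡ = begin
        b                                  ≡⟨ iter-undo (toℕ j′) b (<⇒≤ (toℕ<n j′)) ⟨
        iter (t ∸ toℕ j′) (iter (toℕ j′) b) ≡⟨ cong (iter (t ∸ toℕ j′)) e ⟨
        iter (t ∸ toℕ j′) (iter (toℕ j) a)  ≡⟨ iter-+ (t ∸ toℕ j′) (toℕ j) a ⟨
        iter d a                           ≡⟨ iter-mod d a ⟩
        iter (d % t) a                     ≡⟨ cong (λ z → iter z a) (toℕ-fromℕ< (m%n<n d t)) ⟨
        iter (toℕ i) a                     ∎
        where open ≡-Reasoning

    rep-exists : ∀ y → ∃ λ j → j < t × IsRep (iter j y)
    rep-exists y with argmin (λ j → idx (iter j y)) t (>-nonZero⁻¹ t)
    ... | j , j<t , j-min = j , j<t , λ i → subst (λ z → idx (iter j y) ≤ idx z) (sym (shift i)) (j-min _ (m%n<n (toℕ i + j) t))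
      where
      shift : ∀ (i : Fin t) → iter (toℕ i) (iter j y) ≡ iter ((toℕ i + j) % t) y
      shift i = trans (sym (iter-+ (toℕ i) j y)) (iter-mod _ y)

    module _ (P : A → Set) (P-stable : ∀ y → P y → P (σ y)) where

      -- The points of P not fixed by σ: r orbits of t points each.
      free-points-card : ∀ {r} → Card (λ y → (P y × ¬ Fixed y) × IsRep y) r →
                         Card (λ y → P y × ¬ Fixed y) (t * r)
      free-points-card {r} R = card h h-injective h-complete h-sound
        where
        rep = enumerate R
        orbit-point : Fin t → Fin r → A
        orbit-point j i = iter (toℕ j) (rep i)
        h : Fin (t * r) → A
        h k = uncurry orbit-point (remQuot {t} r k)

        orbit-point-injective : ∀ j i j′ i′ → orbit-point j i ≡ orbit-point j′ i′ → (j , i) ≡ (j′ , i′)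
        orbit-point-injective j i j′ i′ e
          with enumerate-injective R {i} {i′} (idx-injective _ _ (≤-antisym
                 (rep-least (rep i) (rep i′) j j′ e (proj₂ (enumerate-sound R i)))
                 (rep-least (rep i′) (rep i) j′ j (sym e) (proj₂ (enumerate-sound R i′)))))
        ... | refl with <-cmp (toℕ j) (toℕ j′)
        ... | tri≈ _ j≡j′ _ = cong (_, i) (toℕ-injective j≡j′)
        ... | tri< j<j′ _ _ = ⊥-elim (free-orbit-injective (rep i) (proj₂ (proj₁ (enumerate-sound R i))) _ _ j<j′ (toℕ<n j′) e)
        ... | tri> _ _ j>j′ = ⊥-elim (free-orbit-injective (rep i) (proj₂ (proj₁ (enumerate-sound R i))) _ _ j>j′ (toℕ<n j) (sym e))

        h-injective : Injective _≡_ _≡_ h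
        h-injective {k} {k′} e = begin
          k                                ≡⟨ combine-remQuot {t} r k ⟨
          uncurry combine (remQuot {t} r k) ≡⟨ cong (uncurry combine) (orbit-point-injective _ _ _ _ e) ⟩
          uncurry combine (remQuot {t} r k′) ≡⟨ combine-remQuot {t} r k′ ⟩
          k′                               ∎
          where open ≡-Reasoning

        free-point-stable : ∀ m y → P y × ¬ Fixed y → P (iter m y) × ¬ Fixed (iter m y)
        free-point-stable m y (py , not-fixed) = iter-stable P P-stable m y py , free-stable m y not-fixed

        h-sound : ∀ k → P (h k) × ¬ Fixed (h k)
        h-sound k = free-point-stable (toℕ (proj₁ (remQuot {t} r k))) _ (proj₁ (enumerate-sound R (proj₂ (remQuot {t} r k))))

        h-complete : ∀ y → P y × ¬ Fixed y → ∃ λ k → h k ≡ y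
        h-complete y free with rep-exists y
        ... | js , js<t , is-rep with enumerate-complete R (iter js y) (free-point-stable js y free , is-rep)
        ... | i , rep-i = combine j i , (begin
          h (combine j i)               ≡⟨ cong (uncurry orbit-point) (remQuot-combine j i) ⟩
          iter (toℕ j) (rep i)          ≡⟨ cong₂ iter (toℕ-fromℕ< (m%n<n (t ∸ js) t)) rep-i ⟩
          iter ((t ∸ js) % t) (iter js y) ≡⟨ iter-mod _ _ ⟨
          iter (t ∸ js) (iter js y)     ≡⟨ iter-undo js y (<⇒≤ js<t) ⟩
          y                             ∎)
          where
          open ≡-Reasoning
          j = fromℕ< (m%n<n (t ∸ js) t)

      card-≡-fixed-mod : ∀ {n F} → Card P n → Card (λ y → P y × Fixed y) F → ∃ λ r → n ≡ F + t * r
      card-≡-fixed-mod {n} {F} C C-fixed with card-split Fixed (λ y → σ y ≟ y) C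
      ... | a , b , n≡a+b , C₁ , C₂ with card-split IsRep isRep? C₂
      ... | r , _ , _ , R , _ =
        r , trans n≡a+b (cong₂ _+_ (card-unique C₁ C-fixed) (card-unique C₂ (free-points-card R)))

module FieldBasics where

  open import Level using (0ℓ)
  open import Defs
  open import Data.Nat as ℕ using (ℕ; zero; suc; _∸_; _≤_; _<_; s≤s; z≤n)
  import Data.Nat.Properties as ℕP
  open import Data.Nat.Primality using (Prime; euclidsLemma; prime⇒nonTrivial)
  open import Data.Nat.Divisibility using (_∣_; divides; ∣1⇒≡1; ∣⇒≤; m∣m*n)
  open import Data.Nat.DivMod using (m/n*n≡m)
  open import Data.Nat.Combinatorics using (_C_; nCn≡1; nCk≡nC[n∸k]; nCk≡n!/k![n-k]!; k![n∸k]!∣n!)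
  open import Data.Fin as F using (Fin; toℕ)
  open import Data.Fin.Properties using (toℕ-fromℕ; toℕ-inject₁; toℕ<n; toℕ-injective)
  open import Data.Product using (_,_)
  open import Data.Sum using (inj₁; inj₂)
  open import Data.Empty using (⊥-elim)
  open import Relation.Nullary using (¬_; Dec; yes; no)
  open import Relation.Binary.PropositionalEquality
  open import Algebra.Bundles using (CommutativeRing)
  open import Function.Bundles using (Inverse)
  import Algebra.Structures as AS
  import Algebra.Properties.CommutativeSemiring.Binomial as Binomial
  import Algebra.Properties.CommutativeSemiring.Exp as Exp
  import Algebra.Properties.Semiring.Mult as Mult
  import Algebra.Properties.Semiring.Sum as Sum

  prime≥2 : ∀ {p} → Prime p → 2 ≤ p
  prime≥2 {p} p-prime = ℕ.nonTrivial⇒n>1 p {{prime⇒nonTrivial p-prime}}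

  prime∤factorial : ∀ {p} → Prime p → ∀ m → m < p → ¬ p ∣ m ℕ.!
  prime∤factorial p-prime zero m<p p∣1 with ∣1⇒≡1 p∣1 | prime≥2 p-prime
  ... | refl | s≤s ()
  prime∤factorial p-prime (suc m) m<p p∣m! with euclidsLemma (suc m) (m ℕ.!) p-prime p∣m!
  ... | inj₁ p∣1+m = ℕP.<⇒≱ m<p (∣⇒≤ p∣1+m)
  ... | inj₂ p∣m!′ = prime∤factorial p-prime m (ℕP.<-trans (ℕP.n<1+n m) m<p) p∣m!′

  prime∣binomial : ∀ {p k} → Prime p → 0 < k → k < p → p ∣ p C k
  prime∣binomial {p} {k} p-prime 0<k k<p
    with euclidsLemma (p C k) (k ℕ.! ℕ.* (p ∸ k) ℕ.!) p-prime p∣product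
    where
    instance _ = ℕP._!*_!≢0 k (p ∸ k)
    p∣p! : p ∣ p ℕ.!
    p∣p! = n∣n! p (prime≥2 p-prime)
      where
      n∣n! : ∀ n → 2 ≤ n → n ∣ n ℕ.!
      n∣n! (suc n) _ = m∣m*n (n ℕ.!)
    -- (p choose k) · k! · (p-k)! = p!
    p∣product : p ∣ (p C k) ℕ.* (k ℕ.! ℕ.* (p ∸ k) ℕ.!)
    p∣product = subst (p ∣_) (sym (trans (cong (ℕ._* (k ℕ.! ℕ.* (p ∸ k) ℕ.!)) (nCk≡n!/k![n-k]! (ℕP.<⇒≤ k<p)))
                                         (m/n*n≡m (k![n∸k]!∣n! (ℕP.<⇒≤ k<p))))) p∣p!
  ... | inj₁ p∣pCk = p∣pCk
  ... | inj₂ p∣k![p-k]! with euclidsLemma (k ℕ.!) ((p ∸ k) ℕ.!) p-prime p∣k![p-k]!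
  ... | inj₁ p∣k! = ⊥-elim (prime∤factorial p-prime k k<p p∣k!)
  ... | inj₂ p∣[p-k]! = ⊥-elim (prime∤factorial p-prime (p ∸ k) (ℕP.∸-monoʳ-< 0<k (ℕP.<⇒≤ k<p)) p∣[p-k]!)

  module FieldAlgebra (L : FiniteField) where

    open FiniteField L public
    open AS.IsCommutativeRing isCommutativeRing public
      hiding (sym; trans; refl; reflexive; isEquivalence; setoid)
    open ≡-Reasoning

    ring : CommutativeRing 0ℓ 0ℓ
    ring = record { isCommutativeRing = isCommutativeRing }

    open Exp (CommutativeRing.commutativeSemiring ring) using (_^_; ^-distrib-*)
    open Mult (CommutativeRing.semiring ring) using (×-assoc-*; ×1-homo-*) renaming (_×_ to _·_)
    open Sum (CommutativeRing.semiring ring) using (sum)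
    open Binomial (CommutativeRing.commutativeSemiring ring) using (binomialTerm; binomial)
      renaming (theorem to binomial-theorem)

    ^-+ : ∀ x a b → x ^' (a ℕ.+ b) ≡ x ^' a * x ^' b
    ^-+ x zero b = sym (*-identityˡ _)
    ^-+ x (suc a) b = trans (cong (x *_) (^-+ x a b)) (sym (*-assoc _ _ _))

    ^-* : ∀ x a b → x ^' (a ℕ.* b) ≡ (x ^' a) ^' b
    ^-* x a zero = cong (x ^'_) (ℕP.*-zeroʳ a)
    ^-* x a (suc b) = begin
      x ^' (a ℕ.* suc b)          ≡⟨ cong (x ^'_) (ℕP.*-suc a b) ⟩
      x ^' (a ℕ.+ a ℕ.* b)        ≡⟨ ^-+ x a (a ℕ.* b) ⟩
      x ^' a * x ^' (a ℕ.* b)     ≡⟨ cong (x ^' a *_) (^-* x a b) ⟩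
      x ^' a * (x ^' a) ^' b      ∎

    1-^ : ∀ n → 1# ^' n ≡ 1#
    1-^ zero = refl
    1-^ (suc n) = trans (*-identityˡ _) (1-^ n)

    ^'≡^ : ∀ x n → x ^' n ≡ x ^ n
    ^'≡^ x zero = refl
    ^'≡^ x (suc n) = cong (x *_) (^'≡^ x n)

    *-^ : ∀ x y n → (x * y) ^' n ≡ x ^' n * y ^' n
    *-^ x y n = begin
      (x * y) ^' n       ≡⟨ ^'≡^ (x * y) n ⟩
      (x * y) ^ n        ≡⟨ ^-distrib-* x y n ⟩
      x ^ n * y ^ n      ≡⟨ cong₂ _*_ (^'≡^ x n) (^'≡^ y n) ⟨
      x ^' n * y ^' n    ∎

    *-cancelˡ : ∀ x y z → x ≢ 0# → x * y ≡ x * z → y ≡ z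
    *-cancelˡ x y z x≢0 e with inverse x x≢0
    ... | x⁻¹ , xx⁻¹≡1 = begin
      y              ≡⟨ *-identityˡ y ⟨
      1# * y         ≡⟨ cong (_* y) (trans (sym xx⁻¹≡1) (*-comm x x⁻¹)) ⟩
      x⁻¹ * x * y    ≡⟨ *-assoc _ _ _ ⟩
      x⁻¹ * (x * y)  ≡⟨ cong (x⁻¹ *_) e ⟩
      x⁻¹ * (x * z)  ≡⟨ *-assoc _ _ _ ⟨
      x⁻¹ * x * z    ≡⟨ cong (_* z) (trans (*-comm x⁻¹ x) xx⁻¹≡1) ⟩
      1# * z         ≡⟨ *-identityˡ z ⟩
      z              ∎

    *-nonzero : ∀ x y → x ≢ 0# → y ≢ 0# → x * y ≢ 0#
    *-nonzero x y x≢0 y≢0 e = y≢0 (*-cancelˡ x y 0# x≢0 (trans e (sym (zeroʳ x))))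

    ^-nonzero : ∀ x n → x ≢ 0# → x ^' n ≢ 0#
    ^-nonzero x zero x≢0 e = 0≢1 (sym e)
    ^-nonzero x (suc n) x≢0 = *-nonzero x (x ^' n) x≢0 (^-nonzero x n x≢0)

    index : Carrier → ℕ
    index x = toℕ (Inverse.from enum x)

    index-injective : ∀ x y → index x ≡ index y → x ≡ y
    index-injective x y e = begin
      x                                ≡⟨ Inverse.strictlyInverseˡ enum x ⟨
      Inverse.to enum (Inverse.from enum x) ≡⟨ cong (Inverse.to enum) (toℕ-injective e) ⟩
      Inverse.to enum (Inverse.from enum y) ≡⟨ Inverse.strictlyInverseˡ enum y ⟩
      y                                ∎

    _≟_ : (x y : Carrier) → Dec (x ≡ y)
    x ≟ y with index x ℕP.≟ index y
    ... | yes e = yes (index-injective x y e)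
    ... | no ne = no λ e → ne (cong index e)

    ι≡· : ∀ n → ι n ≡ n · 1#
    ι≡· zero = refl
    ι≡· (suc n) = cong (1# +_) (ι≡· n)

    ι-* : ∀ a b → ι (a ℕ.* b) ≡ ι a * ι b
    ι-* a b = begin
      ι (a ℕ.* b)             ≡⟨ ι≡· (a ℕ.* b) ⟩
      (a ℕ.* b) · 1#          ≡⟨ ×1-homo-* a b ⟩
      (a · 1#) * (b · 1#)     ≡⟨ cong₂ _*_ (ι≡· a) (ι≡· b) ⟨
      ι a * ι b               ∎

    ·≡ι* : ∀ n x → n · x ≡ ι n * x
    ·≡ι* n x = begin
      n · x             ≡⟨ cong (n ·_) (*-identityˡ x) ⟨
      n · (1# * x)      ≡⟨ ×-assoc-* n 1# x ⟨
      (n · 1#) * x      ≡⟨ cong (_* x) (ι≡· n) ⟨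
      ι n * x           ∎

    sum-last : ∀ n (f : Fin (suc n) → Carrier) → (∀ (i : Fin n) → f (F.inject₁ i) ≡ 0#) →
               sum f ≡ f (F.fromℕ n)
    sum-last zero f _ = +-identityʳ _
    sum-last (suc n) f vanish = begin
      f F.zero + sum (λ i → f (F.suc i))  ≡⟨ cong₂ _+_ (vanish F.zero) (sum-last n (λ i → f (F.suc i)) (λ i → vanish (F.suc i))) ⟩
      0# + f (F.suc (F.fromℕ n))          ≡⟨ +-identityˡ _ ⟩
      f (F.fromℕ (suc n))                 ∎

    -- In characteristic p, (x + y)^p = x^p + y^p: the binomial coefficients
    -- (p choose k), 0 < k < p, are multiples of p, hence vanish in L.
    freshman : ∀ {p} → Prime p → ι p ≡ 0# → ∀ x y → (x + y) ^' p ≡ x ^' p + y ^' p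
    freshman {p} p-prime ιp≡0 x y with p | prime≥2 p-prime | p-prime | ιp≡0
    ... | suc p′ | _ | p-prime′ | ιp≡0′ = begin
      (x + y) ^' P                       ≡⟨ ^'≡^ (x + y) P ⟩
      (x + y) ^ P                        ≡⟨ binomial-theorem P x y ⟩
      T F.zero + sum (λ i → T (F.suc i)) ≡⟨ cong (T F.zero +_) (sum-last p′ (λ i → T (F.suc i)) middle-vanishes) ⟩
      T F.zero + T (F.suc (F.fromℕ p′))  ≡⟨ cong₂ _+_ first-term last-term ⟩
      y ^' P + x ^' P                    ≡⟨ +-comm _ _ ⟩
      x ^' P + y ^' P                    ∎
      where
      P = suc p′
      T = binomialTerm x y P
      B = binomial x y P
      middle-vanishes : ∀ (i : Fin p′) → T (F.suc (F.inject₁ i)) ≡ 0#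
      middle-vanishes i with prime∣binomial {P} {suc (toℕ (F.inject₁ i))} p-prime′ (s≤s z≤n)
                               (s≤s (subst (ℕ._< p′) (sym (toℕ-inject₁ i)) (toℕ<n i)))
      ... | divides c pCk≡c*p = begin
        T (F.suc (F.inject₁ i))                       ≡⟨ ·≡ι* (P C suc (toℕ (F.inject₁ i))) _ ⟩
        ι (P C suc (toℕ (F.inject₁ i))) * B (F.suc (F.inject₁ i)) ≡⟨ cong (λ z → ι z * B (F.suc (F.inject₁ i))) pCk≡c*p ⟩
        ι (c ℕ.* P) * B (F.suc (F.inject₁ i))         ≡⟨ cong (_* B (F.suc (F.inject₁ i))) (trans (ι-* c P) (trans (cong (ι c *_) ιp≡0′) (zeroʳ _))) ⟩
        0# * B (F.suc (F.inject₁ i))                  ≡⟨ zeroˡ _ ⟩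
        0#                                            ∎
      first-term : T F.zero ≡ y ^' P
      first-term = begin
        T F.zero                   ≡⟨ ·≡ι* (P C 0) (B F.zero) ⟩
        ι (P C 0) * (1# * y ^ P)   ≡⟨ cong (λ z → ι z * (1# * y ^ P)) (trans (nCk≡nC[n∸k] {n = P} z≤n) (nCn≡1 P)) ⟩
        (1# + 0#) * (1# * y ^ P)   ≡⟨ cong₂ _*_ (+-identityʳ 1#) (*-identityˡ _) ⟩
        1# * y ^ P                 ≡⟨ *-identityˡ _ ⟩
        y ^ P                      ≡⟨ ^'≡^ y P ⟨
        y ^' P                     ∎
      last-term : T (F.suc (F.fromℕ p′)) ≡ x ^' P
      last-term = begin
        T (F.suc (F.fromℕ p′))                                          ≡⟨ ·≡ι* (P C suc (toℕ (F.fromℕ p′))) _ ⟩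
        ι (P C suc (toℕ (F.fromℕ p′))) * (x ^ suc (toℕ (F.fromℕ p′)) * y ^ (p′ ∸ toℕ (F.fromℕ p′)))
          ≡⟨ cong (λ j → ι (P C suc j) * (x ^ suc j * y ^ (p′ ∸ j))) (toℕ-fromℕ p′) ⟩
        ι (P C P) * (x ^ P * y ^ (p′ ∸ p′))   ≡⟨ cong₂ (λ a b → ι a * (x ^ P * y ^ b)) (nCn≡1 P) (ℕP.n∸n≡0 p′) ⟩
        (1# + 0#) * (x ^ P * 1#)              ≡⟨ cong₂ _*_ (+-identityʳ 1#) (*-identityʳ _) ⟩
        1# * x ^ P                            ≡⟨ *-identityˡ _ ⟩
        x ^ P                                 ≡⟨ ^'≡^ x P ⟨
        x ^' P                                ∎

module FermatPrimitive where

  open Cardinality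
  open FieldBasics
  open import Defs
  open import Data.Nat as ℕ using (ℕ; zero; suc; _∸_; _≤_; _<_; s≤s; z≤n; _%_; _/_; NonZero)
  import Data.Nat.Properties as ℕP
  open import Data.Nat.DivMod using (m≡m%n+[m/n]*n; m%n<n)
  open import Data.Nat.Divisibility using (_∣_; m%n≡0⇒n∣m)
  open import Data.Fin as F using (Fin; toℕ; fromℕ<)
  open import Data.Fin.Properties using (pigeonhole; toℕ-fromℕ<; toℕ-injective; toℕ<n)
  open import Data.Product using (∃; _×_; _,_; proj₁; proj₂)
  open import Data.Sum using (_⊎_; inj₁; inj₂; [_,_]′)
  open import Data.Empty using (⊥-elim)
  open import Data.Unit using (⊤; tt)
  open import Relation.Nullary using (¬_; Dec; yes; no)
  open import Relation.Binary.PropositionalEquality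
  open import Relation.Binary.Definitions using (tri<; tri≈; tri>)
  open import Function.Bundles using (Inverse)

  least : (P : ℕ → Set) → (∀ n → Dec (P n)) → ∀ n → P n → ∃ λ m → P m × (∀ j → j < m → ¬ P j)
  least P P? n pn with search (suc n)
    where
    search : ∀ bound → (∃ λ m → P m × (∀ j → j < m → ¬ P j)) ⊎ (∀ j → j < bound → ¬ P j)
    search zero = inj₂ λ _ ()
    search (suc b) with search b
    ... | inj₁ found = inj₁ found
    ... | inj₂ none-below with P? b
    ... | yes pb = inj₁ (b , pb , none-below)
    ... | no ¬pb = inj₂ λ j j<1+b → [ none-below j , (λ { refl → ¬pb }) ]′ (ℕP.m<1+n⇒m<n∨m≡n j<1+b)
  ... | inj₁ found = found
  ... | inj₂ none = ⊥-elim (none n ℕP.≤-refl pn)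

  module PrimitiveElement (L : FiniteField) (γ : FiniteField.Carrier L)
    (γ-primitive : FiniteField.Primitive L γ) (size≥3 : 3 ≤ FiniteField.size L) where

    open FieldAlgebra L
    open ≡-Reasoning

    all-elements : Card (λ (_ : Carrier) → ⊤) size
    all-elements = card (Inverse.to enum)
      (λ {i} {j} e → trans (sym (Inverse.strictlyInverseʳ enum i)) (trans (cong (Inverse.from enum) e) (Inverse.strictlyInverseʳ enum j)))
      (λ y _ → Inverse.from enum y , Inverse.strictlyInverseˡ enum y) (λ _ → tt)

    -- If γ were 0, every element would be 0 or 1 = γ^0.
    γ-nonzero : γ ≢ 0#
    γ-nonzero γ≡0 = ℕP.<-irrefl refl (subst (2 ℕ.<_) (card-unique all-elements two-elements) size≥3)
      where
      h : Fin 2 → Carrier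
      h F.zero = 0#
      h (F.suc F.zero) = 1#
      h-injective : ∀ {i j} → h i ≡ h j → i ≡ j
      h-injective {F.zero} {F.zero} _ = refl
      h-injective {F.suc F.zero} {F.suc F.zero} _ = refl
      h-injective {F.zero} {F.suc F.zero} e = ⊥-elim (0≢1 e)
      h-injective {F.suc F.zero} {F.zero} e = ⊥-elim (0≢1 (sym e))
      h-complete : ∀ y → ⊤ → ∃ λ j → h j ≡ y
      h-complete y _ with y ≟ 0#
      ... | yes y≡0 = F.zero , sym y≡0
      ... | no y≢0 with γ-primitive y y≢0
      ... | zero , y≡1 = F.suc F.zero , sym y≡1
      ... | suc k , y≡γ^k = ⊥-elim (y≢0 (trans y≡γ^k (trans (cong (_^' suc k) γ≡0) (zeroˡ _))))
      two-elements : Card (λ (_ : Carrier) → ⊤) 2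
      two-elements = card h h-injective h-complete (λ _ → tt)

    γ^-nonzero : ∀ e → γ ^' e ≢ 0#
    γ^-nonzero e = ^-nonzero γ e γ-nonzero

    power-collision : ∀ i j → i < j → γ ^' i ≡ γ ^' j → γ ^' (j ∸ i) ≡ 1#
    power-collision i j i<j e = *-cancelˡ (γ ^' i) _ _ (γ^-nonzero i) (begin
      γ ^' i * γ ^' (j ∸ i)  ≡⟨ *-comm _ _ ⟩
      γ ^' (j ∸ i) * γ ^' i  ≡⟨ ^-+ γ (j ∸ i) i ⟨
      γ ^' (j ∸ i ℕ.+ i)     ≡⟨ cong (γ ^'_) (ℕP.m∸n+n≡m (ℕP.<⇒≤ i<j)) ⟩
      γ ^' j                 ≡⟨ e ⟨
      γ ^' i                 ≡⟨ *-identityʳ _ ⟨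
      γ ^' i * 1#            ∎)

    IsPeriod : ℕ → Set
    IsPeriod d = 1 ≤ d × γ ^' d ≡ 1#

    isPeriod? : ∀ d → Dec (IsPeriod d)
    isPeriod? d with 1 ℕ.≤? d | (γ ^' d) ≟ 1#
    ... | yes d≥1 | yes γ^d≡1 = yes (d≥1 , γ^d≡1)
    ... | no d≱1 | _ = no λ per → d≱1 (proj₁ per)
    ... | _ | no γ^d≢1 = no λ per → γ^d≢1 (proj₂ per)

    -- By pigeonhole among γ^0, …, γ^|L| some period exists; take the least one.
    order : ∃ λ d → IsPeriod d × (∀ j → j < d → ¬ IsPeriod j)
    order with pigeonhole (ℕP.n<1+n size) (λ (i : Fin (suc size)) → Inverse.from enum (γ ^' toℕ i))
    ... | i , j , i<j , e = least IsPeriod isPeriod? (toℕ j ∸ toℕ i) (ℕP.m<n⇒0<n∸m i<j ,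
          power-collision (toℕ i) (toℕ j) i<j
            (trans (sym (Inverse.strictlyInverseˡ enum _)) (trans (cong (Inverse.to enum) e) (Inverse.strictlyInverseˡ enum _))))

    -- The least period d; opaque, so that it is never computed.
    opaque
      d : ℕ
      d = proj₁ order

      d≥1 : 1 ≤ d
      d≥1 = proj₁ (proj₁ (proj₂ order))

      γ^d≡1 : γ ^' d ≡ 1#
      γ^d≡1 = proj₂ (proj₁ (proj₂ order))

      d-least : ∀ j → j < d → ¬ IsPeriod j
      d-least = proj₂ (proj₂ order)

    instance
      d-nonZero : NonZero d
      d-nonZero = ℕ.>-nonZero d≥1

    ^-mod-order : ∀ e → γ ^' e ≡ γ ^' (e % d)
    ^-mod-order e = begin
      γ ^' e                                 ≡⟨ cong (γ ^'_) (trans (m≡m%n+[m/n]*n e d) (cong (e % d ℕ.+_) (ℕP.*-comm (e / d) d))) ⟩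
      γ ^' (e % d ℕ.+ d ℕ.* (e / d))         ≡⟨ ^-+ γ (e % d) _ ⟩
      γ ^' (e % d) * γ ^' (d ℕ.* (e / d))    ≡⟨ cong (γ ^' (e % d) *_) (^-* γ d (e / d)) ⟩
      γ ^' (e % d) * (γ ^' d) ^' (e / d)     ≡⟨ cong (λ z → γ ^' (e % d) * z ^' (e / d)) γ^d≡1 ⟩
      γ ^' (e % d) * 1# ^' (e / d)           ≡⟨ cong (γ ^' (e % d) *_) (1-^ (e / d)) ⟩
      γ ^' (e % d) * 1#                      ≡⟨ *-identityʳ _ ⟩
      γ ^' (e % d)                           ∎

    order-divides : ∀ e → γ ^' e ≡ 1# → d ∣ e
    order-divides e γ^e≡1 with e % d in e%d
    ... | zero = m%n≡0⇒n∣m e d e%d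
    ... | suc r = ⊥-elim (d-least (suc r) (subst (ℕ._< d) e%d (m%n<n e d))
                    (s≤s z≤n , trans (sym (trans (^-mod-order e) (cong (γ ^'_) e%d))) γ^e≡1))

    -- The nonzero elements are exactly γ^0, …, γ^(d-1), so |L| = 1 + d.
    nonzero-elements : Card (λ x → x ≢ 0#) d
    nonzero-elements = card (λ i → γ ^' toℕ i) h-injective h-complete (λ i → γ^-nonzero (toℕ i))
      where
      distinct : ∀ i j → i < j → j < d → γ ^' i ≢ γ ^' j
      distinct i j i<j j<d e = d-least (j ∸ i) (ℕP.≤-<-trans (ℕP.m∸n≤m j i) j<d)
                                 (ℕP.m<n⇒0<n∸m i<j , power-collision i j i<j e)
      h-injective : ∀ {i j : Fin d} → γ ^' toℕ i ≡ γ ^' toℕ j → i ≡ j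
      h-injective {i} {j} e with ℕP.<-cmp (toℕ i) (toℕ j)
      ... | tri≈ _ i≡j _ = toℕ-injective i≡j
      ... | tri< i<j _ _ = ⊥-elim (distinct _ _ i<j (toℕ<n j) e)
      ... | tri> _ _ j<i = ⊥-elim (distinct _ _ j<i (toℕ<n i) (sym e))
      h-complete : ∀ y → y ≢ 0# → ∃ λ (j : Fin d) → γ ^' toℕ j ≡ y
      h-complete y y≢0 with γ-primitive y y≢0
      ... | e , y≡γ^e = fromℕ< (m%n<n e d) , trans (cong (γ ^'_) (toℕ-fromℕ< (m%n<n e d))) (sym (trans y≡γ^e (^-mod-order e)))

    size≡1+d : size ≡ suc d
    size≡1+d with card-split (λ x → x ≡ 0#) (λ x → x ≟ 0#) all-elements
    ... | a , b , size≡a+b , zeros , nonzeros =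
      trans size≡a+b (cong₂ ℕ._+_ (card-unique zeros only-zero)
                                   (card-unique′ (λ _ → proj₂) (λ _ y≢0 → tt , y≢0) nonzeros nonzero-elements))
      where
      fin1-unique : (i j : Fin 1) → i ≡ j
      fin1-unique F.zero F.zero = refl
      only-zero : Card (λ x → ⊤ × x ≡ 0#) 1
      only-zero = card (λ _ → 0#) (λ {i} {j} _ → fin1-unique i j) (λ y p → F.zero , sym (proj₂ p)) (λ _ → tt , refl)

    Q : ℕ
    Q = size ∸ 1

    Q≡d : Q ≡ d
    Q≡d = cong (_∸ 1) size≡1+d

    γ^Q≡1 : γ ^' Q ≡ 1#
    γ^Q≡1 = trans (cong (γ ^'_) Q≡d) γ^d≡1

    Q∣-order : ∀ e → γ ^' e ≡ 1# → Q ∣ e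
    Q∣-order e γ^e≡1 = subst (_∣ e) (sym Q≡d) (order-divides e γ^e≡1)

    fermat : ∀ y → y ^' size ≡ y
    fermat y with y ≟ 0#
    ... | yes refl = trans (cong (0# ^'_) size≡1+d) (zeroˡ _)
    ... | no y≢0 with γ-primitive y y≢0
    ... | e , refl = begin
      (γ ^' e) ^' size            ≡⟨ cong ((γ ^' e) ^'_) size≡1+d ⟩
      γ ^' e * (γ ^' e) ^' d      ≡⟨ cong (γ ^' e *_) (^-* γ e d) ⟨
      γ ^' e * γ ^' (e ℕ.* d)     ≡⟨ cong (λ z → γ ^' e * γ ^' z) (ℕP.*-comm e d) ⟩
      γ ^' e * γ ^' (d ℕ.* e)     ≡⟨ cong (γ ^' e *_) (^-* γ d e) ⟩
      γ ^' e * (γ ^' d) ^' e      ≡⟨ cong (λ z → γ ^' e * z ^' e) γ^d≡1 ⟩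
      γ ^' e * 1# ^' e            ≡⟨ cong (γ ^' e *_) (1-^ e) ⟩
      γ ^' e * 1#                 ≡⟨ *-identityʳ _ ⟩
      γ ^' e                      ∎

module FrobeniusLift where

  open Cardinality
  open Orbits
  open FieldBasics
  open FermatPrimitive
  open import Defs
  open import Data.Nat as ℕ using (ℕ; zero; suc; _∸_; _≤_; s≤s; z≤n; _%_; NonZero)
  import Data.Nat.Properties as ℕP
  open import Data.Nat.DivMod using (m%n<n; [m+kn]%n≡m%n; m<n⇒m%n≡m)
  open import Data.Nat.Divisibility using (_∣_; divides; ∣m⇒∣m*n; ∣n⇒∣m*n; *-cancelˡ-∣)
  open import Data.Nat.Primality using (Prime)
  open import Data.Nat.Tactic.RingSolver using (solve-∀)
  open import Data.Fin as F using (Fin; toℕ; fromℕ<)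
  open import Data.Fin.Subset using (Subset; _∈_)
  open import Data.Fin.Properties using (toℕ-fromℕ<; toℕ-injective; toℕ<n)
  open import Data.Product using (∃; _×_; _,_; proj₁; proj₂)
  open import Relation.Binary.PropositionalEquality

  module Frobenius (L : FiniteField) {p : ℕ} (p-prime : Prime p)
    (ιp≡0 : FiniteField.ι L p ≡ FiniteField.0# L) (n : ℕ) where

    open FieldAlgebra L
    open ≡-Reasoning

    q : ℕ
    q = p ℕ.^ n

    σ : Carrier → Carrier
    σ y = y ^' q

    ^p^-+ : ∀ n x y → (x + y) ^' (p ℕ.^ n) ≡ x ^' (p ℕ.^ n) + y ^' (p ℕ.^ n)
    ^p^-+ zero x y = trans (*-identityʳ _) (cong₂ _+_ (sym (*-identityʳ x)) (sym (*-identityʳ y)))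
    ^p^-+ (suc n) x y = begin
      (x + y) ^' (p ℕ.* p ℕ.^ n)                   ≡⟨ ^-* (x + y) p _ ⟩
      ((x + y) ^' p) ^' (p ℕ.^ n)                  ≡⟨ cong (_^' (p ℕ.^ n)) (freshman p-prime ιp≡0 x y) ⟩
      (x ^' p + y ^' p) ^' (p ℕ.^ n)               ≡⟨ ^p^-+ n _ _ ⟩
      (x ^' p) ^' (p ℕ.^ n) + (y ^' p) ^' (p ℕ.^ n) ≡⟨ cong₂ _+_ (^-* x p _) (^-* y p _) ⟨
      x ^' (p ℕ.* p ℕ.^ n) + y ^' (p ℕ.* p ℕ.^ n)  ∎

    σ-+ : ∀ x y → σ (x + y) ≡ σ x + σ y
    σ-+ = ^p^-+ n

    σ-* : ∀ x y → σ (x * y) ≡ σ x * σ y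
    σ-* x y = *-^ x y q

    σ-^ : ∀ g e → σ (g ^' e) ≡ g ^' (e ℕ.* q)
    σ-^ g e = sym (^-* g e q)

    σ-0 : σ 0# ≡ 0#
    σ-0 with q | ℕP.m^n≢0 p n {{ℕ.>-nonZero (ℕP.≤-trans (s≤s z≤n) (prime≥2 p-prime))}}
    ... | suc _ | _ = zeroˡ _

    σ-ι : ∀ k → σ (ι k) ≡ ι k
    σ-ι zero = σ-0
    σ-ι (suc k) = trans (σ-+ 1# (ι k)) (cong₂ _+_ (1-^ q) (σ-ι k))

  module Lift (L : FiniteField) {p : ℕ} (p-prime : Prime p)
    (ιp≡0 : FiniteField.ι L p ≡ FiniteField.0# L) (n : ℕ)
    (q≥3 : 3 ≤ p ℕ.^ n)
    (t : ℕ) {{_ : NonZero t}} (t-prime : Prime t)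
    (size≡q^t : FiniteField.size L ≡ (p ℕ.^ n) ℕ.^ t)
    (γ : FiniteField.Carrier L) (γ-primitive : FiniteField.Primitive L γ)
    (e₀ : ℕ) (e₀-def : e₀ ℕ.* (p ℕ.^ n ∸ 1) ≡ (p ℕ.^ n) ℕ.^ t ∸ 1)
    (N : ℕ) {{_ : NonZero N}} (q≋1 : (p ℕ.^ n) % N ≡ 1 % N)
    (tinv : ℕ) (t-tinv≋1 : (t ℕ.* tinv) % N ≡ 1 % N)
    (I : Subset N) where

    open FieldAlgebra L
    open Frobenius L p-prime ιp≡0 n
    open Congruence N
    open ≡-Reasoning

    size≥3 : 3 ≤ size
    size≥3 = subst (3 ≤_) (sym size≡q^t) (ℕP.≤-trans q≥3 (subst (_≤ q ℕ.^ t) (ℕP.*-identityʳ q)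
               (ℕP.^-monoʳ-≤ q {{ℕ.>-nonZero (ℕP.≤-trans (s≤s z≤n) q≥3)}} (ℕ.>-nonZero⁻¹ t))))

    open PrimitiveElement L γ γ-primitive size≥3 using (Q; γ^Q≡1; Q∣-order; γ^-nonzero; fermat)

    q′ : ℕ
    q′ = q ∸ 1

    q≡1+q′ : q ≡ suc q′
    q≡1+q′ = sym (ℕP.m+[n∸m]≡n {1} {q} (ℕP.≤-trans (s≤s z≤n) q≥3))

    q′≥1 : 1 ≤ q′
    q′≥1 = ℕP.∸-monoˡ-≤ 1 (ℕP.≤-trans (s≤s (s≤s z≤n)) q≥3)

    Q≥1 : 1 ≤ Q
    Q≥1 = ℕP.∸-monoˡ-≤ {2} {size} 1 (ℕP.≤-trans (s≤s (s≤s z≤n)) size≥3)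

    e₀q′≡Q : e₀ ℕ.* q′ ≡ Q
    e₀q′≡Q = trans e₀-def (cong (_∸ 1) (sym size≡q^t))

    N∣q′ : N ∣ q′
    N∣q′ = ≋⇒∣∸ q≋1 (ℕP.≤-trans (s≤s z≤n) q≥3)

    N∣Q : N ∣ Q
    N∣Q = subst (N ∣_) e₀q′≡Q (∣n⇒∣m*n e₀ N∣q′)

    σ^t≡id : ∀ y → Iteration.iter σ t y ≡ y
    σ^t≡id y = trans (iter≡^ t) (trans (cong (y ^'_) (sym size≡q^t)) (fermat y))
      where
      open Iteration σ
      iter≡^ : ∀ j → iter j y ≡ y ^' (q ℕ.^ j)
      iter≡^ zero = sym (*-identityʳ y)
      iter≡^ (suc j) = begin
        σ (iter j y)               ≡⟨ cong σ (iter≡^ j) ⟩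
        (y ^' (q ℕ.^ j)) ^' q      ≡⟨ ^-* y (q ℕ.^ j) q ⟨
        y ^' (q ℕ.^ j ℕ.* q)       ≡⟨ cong (y ^'_) (ℕP.*-comm (q ℕ.^ j) q) ⟩
        y ^' (q ℕ.^ suc j)         ∎

    -- e₀ = 1 + q + … + q^(t-1) ≡ t (mod N), hence e₀ t⁻¹ ≡ 1 (mod N).
    geometric : ℕ → ℕ
    geometric zero = 0
    geometric (suc j) = 1 ℕ.+ q ℕ.* geometric j

    geometric-sum : ∀ j → q′ ℕ.* geometric j ℕ.+ 1 ≡ q ℕ.^ j
    geometric-sum zero = cong (ℕ._+ 1) (ℕP.*-zeroʳ q′)
    geometric-sum (suc j) = begin
      q′ ℕ.* (1 ℕ.+ q ℕ.* geometric j) ℕ.+ 1      ≡⟨ cong (λ z → q′ ℕ.* (1 ℕ.+ z ℕ.* geometric j) ℕ.+ 1) q≡1+q′ ⟩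
      q′ ℕ.* (1 ℕ.+ suc q′ ℕ.* geometric j) ℕ.+ 1 ≡⟨ identity q′ (geometric j) ⟩
      suc q′ ℕ.* (q′ ℕ.* geometric j ℕ.+ 1)       ≡⟨ cong₂ ℕ._*_ (sym q≡1+q′) (geometric-sum j) ⟩
      q ℕ.* q ℕ.^ j                               ∎
      where
      identity : ∀ a g → a ℕ.* (1 ℕ.+ (1 ℕ.+ a) ℕ.* g) ℕ.+ 1 ≡ (1 ℕ.+ a) ℕ.* (a ℕ.* g ℕ.+ 1)
      identity = solve-∀

    e₀≡geometric : e₀ ≡ geometric t
    e₀≡geometric = ℕP.*-cancelʳ-≡ e₀ (geometric t) q′ {{ℕ.>-nonZero q′≥1}} (begin
      e₀ ℕ.* q′                        ≡⟨ e₀-def ⟩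
      q ℕ.^ t ∸ 1                      ≡⟨ cong (_∸ 1) (geometric-sum t) ⟨
      q′ ℕ.* geometric t ℕ.+ 1 ∸ 1     ≡⟨ ℕP.m+n∸n≡m _ 1 ⟩
      q′ ℕ.* geometric t               ≡⟨ ℕP.*-comm q′ (geometric t) ⟩
      geometric t ℕ.* q′               ∎)

    geometric≋ : ∀ j → geometric j ≋ j
    geometric≋ zero = refl
    geometric≋ (suc j) = trans (≋-+ {1} refl (≋-* q≋1 (geometric≋ j))) (cong (λ z → suc z % N) (ℕP.*-identityˡ j))

    e₀tinv≋1 : e₀ ℕ.* tinv ≋ 1
    e₀tinv≋1 = trans (≋-* {b = t} (trans (cong (_% N) e₀≡geometric) (geometric≋ t)) (refl {x = tinv % N})) t-tinv≋1

    -- If g^P = 1 with N ∣ P, the exponent of g may be moved within its residue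
    -- class mod N, up to a multiple of N: as x + P y ≡ y (mod N) and x + P y ≥ y.
    exponent-shift : ∀ g P → g ^' P ≡ 1# → 1 ≤ P → N ∣ P → ∀ x y → x ≋ y →
                     ∃ λ k → g ^' x ≡ g ^' (y ℕ.+ N ℕ.* k)
    exponent-shift g P g^P≡1 P≥1 N∣P x y x≋y = k , (begin
      g ^' x                               ≡⟨ *-identityʳ _ ⟨
      g ^' x * 1#                          ≡⟨ cong (g ^' x *_) g^Py≡1 ⟨
      g ^' x * g ^' (P ℕ.* y)              ≡⟨ ^-+ g x _ ⟨
      g ^' (x ℕ.+ P ℕ.* y)                 ≡⟨ cong (g ^'_) (ℕP.m+[n∸m]≡n y≤shifted) ⟨
      g ^' (y ℕ.+ (x ℕ.+ P ℕ.* y ∸ y))     ≡⟨ cong (λ z → g ^' (y ℕ.+ z)) (trans shifted∸y≡k*N (ℕP.*-comm k N)) ⟩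
      g ^' (y ℕ.+ N ℕ.* k)                 ∎)
      where
      shifted≋y : x ℕ.+ P ℕ.* y ≋ y
      shifted≋y = trans (≋-+ x≋y (≋-* {b = 0} (∣⇒≋0 N∣P) (refl {x = y % N}))) (cong (_% N) (ℕP.+-identityʳ y))
      y≤shifted : y ≤ x ℕ.+ P ℕ.* y
      y≤shifted = ℕP.≤-trans (ℕP.m≤n*m y P {{ℕ.>-nonZero P≥1}}) (ℕP.m≤n+m _ x)
      N∣shifted∸y : N ∣ x ℕ.+ P ℕ.* y ∸ y
      N∣shifted∸y = ≋⇒∣∸ shifted≋y y≤shifted
      k = _∣_.quotient N∣shifted∸y
      shifted∸y≡k*N = _∣_.equality N∣shifted∸y
      g^Py≡1 : g ^' (P ℕ.* y) ≡ 1#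
      g^Py≡1 = trans (^-* g P y) (trans (cong (_^' y) g^P≡1) (1-^ y))

    ω : Carrier
    ω = γ ^' e₀

    D′ Dt : Carrier → Set
    D′ = CosetUnion γ N I 1
    Dt = CosetUnion ω N I tinv

    ω^q′≡1 : ω ^' q′ ≡ 1#
    ω^q′≡1 = trans (sym (^-* γ e₀ q′)) (trans (cong (γ ^'_) e₀q′≡Q) γ^Q≡1)

    D′-intro : ∀ i → i ∈ I → ∀ e → e ≋ 1 ℕ.* toℕ i → D′ (γ ^' e)
    D′-intro i i∈I e e≋i with exponent-shift γ Q γ^Q≡1 Q≥1 N∣Q e (1 ℕ.* toℕ i) e≋i
    ... | k , γ^e≡ = i , i∈I , k , γ^e≡

    Dt-intro : ∀ i → i ∈ I → ∀ c → c ≋ tinv ℕ.* toℕ i → Dt (ω ^' c)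
    Dt-intro i i∈I c c≋ with exponent-shift ω q′ ω^q′≡1 q′≥1 N∣q′ c (tinv ℕ.* toℕ i) c≋
    ... | k , ω^c≡ = i , i∈I , k , ω^c≡

    -- D′ is stable under σ, since q ≡ 1 (mod N).
    D′-σ-stable : ∀ y → D′ y → D′ (σ y)
    D′-σ-stable y (i , i∈I , k , y≡γ^E) = subst D′ (sym (trans (cong σ y≡γ^E) (σ-^ γ E)))
        (D′-intro i i∈I (E ℕ.* q) (trans (≋-* {E} refl q≋1) (trans (cong (_% N) (ℕP.*-identityʳ E)) (multiple-≋ _ k))))
      where E = 1 ℕ.* toℕ i ℕ.+ N ℕ.* k

    D′-scale : ∀ e → N ∣ e → ∀ y → D′ y → D′ (γ ^' e * y)
    D′-scale e N∣e y (i , i∈I , k , y≡γ^E) = subst D′ (sym (trans (cong (γ ^' e *_) y≡γ^E) (sym (^-+ γ e E))))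
        (D′-intro i i∈I (e ℕ.+ E) (trans (≋-+ {c = E} (∣⇒≋0 N∣e) refl) (multiple-≋ _ k)))
      where E = 1 ℕ.* toℕ i ℕ.+ N ℕ.* k

    D′-unscale : ∀ e → N ∣ e → ∀ y → D′ (γ ^' e * y) → D′ y
    D′-unscale e N∣e y y∈ = subst D′ cancel (D′-scale (e ℕ.* (Q ∸ 1)) (∣m⇒∣m*n (Q ∸ 1) N∣e) _ y∈)
      where
      γ-inverse : γ ^' (e ℕ.* (Q ∸ 1)) * γ ^' e ≡ 1#
      γ-inverse = begin
        γ ^' (e ℕ.* (Q ∸ 1)) * γ ^' e  ≡⟨ ^-+ γ (e ℕ.* (Q ∸ 1)) e ⟨
        γ ^' (e ℕ.* (Q ∸ 1) ℕ.+ e)    ≡⟨ cong (γ ^'_) (solve-exponent e (Q ∸ 1)) ⟩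
        γ ^' (e ℕ.* (1 ℕ.+ (Q ∸ 1)))  ≡⟨ cong (λ z → γ ^' (e ℕ.* z)) (ℕP.m+[n∸m]≡n Q≥1) ⟩
        γ ^' (e ℕ.* Q)                ≡⟨ cong (γ ^'_) (ℕP.*-comm e Q) ⟩
        γ ^' (Q ℕ.* e)                ≡⟨ ^-* γ Q e ⟩
        (γ ^' Q) ^' e                 ≡⟨ cong (_^' e) γ^Q≡1 ⟩
        1# ^' e                       ≡⟨ 1-^ e ⟩
        1#                            ∎
        where
        solve-exponent : ∀ a b → a ℕ.* b ℕ.+ a ≡ a ℕ.* (1 ℕ.+ b)
        solve-exponent = solve-∀
      cancel : γ ^' (e ℕ.* (Q ∸ 1)) * (γ ^' e * y) ≡ y
      cancel = trans (sym (*-assoc _ _ _)) (trans (cong (_* y) γ-inverse) (*-identityˡ y))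

    -- σ(γ^E) = γ^E · γ^(E (q-1)); so γ^E is σ-fixed iff γ^(E (q-1)) = 1.
    σ-γ^ : ∀ E → σ (γ ^' E) ≡ γ ^' E * γ ^' (E ℕ.* q′)
    σ-γ^ E = begin
      σ (γ ^' E)                   ≡⟨ σ-^ γ E ⟩
      γ ^' (E ℕ.* q)               ≡⟨ cong (λ z → γ ^' (E ℕ.* z)) q≡1+q′ ⟩
      γ ^' (E ℕ.* suc q′)          ≡⟨ cong (γ ^'_) (ℕP.*-suc E q′) ⟩
      γ ^' (E ℕ.+ E ℕ.* q′)        ≡⟨ ^-+ γ E (E ℕ.* q′) ⟩
      γ ^' E * γ ^' (E ℕ.* q′)     ∎

    fixed⇒Q∣ : ∀ E → σ (γ ^' E) ≡ γ ^' E → Q ∣ E ℕ.* q′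
    fixed⇒Q∣ E fixed = Q∣-order (E ℕ.* q′)
      (*-cancelˡ (γ ^' E) _ _ (γ^-nonzero E) (trans (sym (σ-γ^ E)) (trans fixed (sym (*-identityʳ _)))))

    ω^-fixed : ∀ c → σ (ω ^' c) ≡ ω ^' c
    ω^-fixed c = begin
      σ (ω ^' c)                                ≡⟨ cong σ ω^c≡γ^e₀c ⟩
      σ (γ ^' (e₀ ℕ.* c))                       ≡⟨ σ-γ^ (e₀ ℕ.* c) ⟩
      γ ^' (e₀ ℕ.* c) * γ ^' (e₀ ℕ.* c ℕ.* q′)  ≡⟨ cong (λ z → γ ^' (e₀ ℕ.* c) * γ ^' z) exponent ⟩
      γ ^' (e₀ ℕ.* c) * γ ^' (Q ℕ.* c)          ≡⟨ cong (γ ^' (e₀ ℕ.* c) *_) γ^Qc≡1 ⟩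
      γ ^' (e₀ ℕ.* c) * 1#                      ≡⟨ *-identityʳ _ ⟩
      γ ^' (e₀ ℕ.* c)                           ≡⟨ ω^c≡γ^e₀c ⟨
      ω ^' c                                    ∎
      where
      ω^c≡γ^e₀c : ω ^' c ≡ γ ^' (e₀ ℕ.* c)
      ω^c≡γ^e₀c = sym (^-* γ e₀ c)
      exponent : e₀ ℕ.* c ℕ.* q′ ≡ Q ℕ.* c
      exponent = begin
        e₀ ℕ.* c ℕ.* q′    ≡⟨ ℕP.*-assoc e₀ c q′ ⟩
        e₀ ℕ.* (c ℕ.* q′)  ≡⟨ cong (e₀ ℕ.*_) (ℕP.*-comm c q′) ⟩
        e₀ ℕ.* (q′ ℕ.* c)  ≡⟨ ℕP.*-assoc e₀ q′ c ⟨
        e₀ ℕ.* q′ ℕ.* c    ≡⟨ cong (ℕ._* c) e₀q′≡Q ⟩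
        Q ℕ.* c            ∎
      γ^Qc≡1 : γ ^' (Q ℕ.* c) ≡ 1#
      γ^Qc≡1 = trans (^-* γ Q c) (trans (cong (_^' c) γ^Q≡1) (1-^ c))

    Dt⇒D′-fixed : ∀ y → Dt y → D′ y × σ y ≡ y
    Dt⇒D′-fixed y (i , i∈I , k , y≡ω^C) =
      subst D′ (sym (trans y≡ω^C (sym (^-* γ e₀ C)))) (D′-intro i i∈I (e₀ ℕ.* C) e₀C≋i) ,
      trans (cong σ y≡ω^C) (trans (ω^-fixed C) (sym y≡ω^C))
      where
      C = tinv ℕ.* toℕ i ℕ.+ N ℕ.* k
      e₀C≋i : e₀ ℕ.* C ≋ 1 ℕ.* toℕ i
      e₀C≋i = trans (≋-* {e₀} refl (multiple-≋ (tinv ℕ.* toℕ i) k))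
                (trans (cong (_% N) (sym (ℕP.*-assoc e₀ tinv (toℕ i)))) (≋-* {c = toℕ i} e₀tinv≋1 refl))

    D′-fixed⇒Dt : ∀ y → D′ y → σ y ≡ y → Dt y
    D′-fixed⇒Dt y (i , i∈I , k , y≡γ^E) fixed =
      subst Dt (sym (trans y≡γ^E (trans (cong (γ ^'_) (trans E≡c*e₀ (ℕP.*-comm c e₀))) (^-* γ e₀ c))))
        (Dt-intro i i∈I c c≋tinv-i)
      where
      E = 1 ℕ.* toℕ i ℕ.+ N ℕ.* k
      -- Q = e₀ (q-1) divides E (q-1), so e₀ divides E.
      e₀∣E : e₀ ∣ E
      e₀∣E = *-cancelˡ-∣ q′ {{ℕ.>-nonZero q′≥1}}
        (subst₂ _∣_ (trans (sym e₀q′≡Q) (ℕP.*-comm e₀ q′)) (ℕP.*-comm E q′)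
          (fixed⇒Q∣ E (trans (cong σ (sym y≡γ^E)) (trans fixed y≡γ^E))))
      c = _∣_.quotient e₀∣E
      E≡c*e₀ = _∣_.equality e₀∣E
      -- c ≡ t⁻¹ e₀ c = t⁻¹ E ≡ t⁻¹ i (mod N).
      c≋tinv-i : c ≋ tinv ℕ.* toℕ i
      c≋tinv-i = begin
        c % N                     ≡⟨ cong (_% N) (ℕP.*-identityˡ c) ⟨
        (1 ℕ.* c) % N             ≡⟨ ≋-* {c = c} (sym (trans (cong (_% N) (ℕP.*-comm tinv e₀)) e₀tinv≋1)) refl ⟩
        (tinv ℕ.* e₀ ℕ.* c) % N   ≡⟨ cong (_% N) (trans (ℕP.*-assoc tinv e₀ c) (cong (tinv ℕ.*_) (trans (ℕP.*-comm e₀ c) (sym E≡c*e₀)))) ⟩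
        (tinv ℕ.* E) % N          ≡⟨ ≋-* {tinv} refl (trans (multiple-≋ (1 ℕ.* toℕ i) k) (cong (_% N) (ℕP.*-identityˡ (toℕ i)))) ⟩
        (tinv ℕ.* toℕ i) % N      ∎

    triple-scale : (E : Carrier → Set) (a c : Carrier) → c ≢ 0# →
                   (∀ y → E y → E (c * y)) → (∀ y → E (c * y) → E y) →
                   ∀ x {m} → Card (TripleSet E x a) m → Card (TripleSet E (c * x) a) m
    triple-scale E a c c≢0 up down x C with inverse c c≢0
    ... | c⁻¹ , cc⁻¹≡1 = card (λ j → c * enumerate C j)
        (λ e → enumerate-injective C (*-cancelˡ c _ _ c≢0 e)) h-complete h-sound
      where
      c-a : ∀ z → c * (a * z) ≡ a * (c * z)
      c-a z = trans (sym (*-assoc c a z)) (trans (cong (_* z) (*-comm c a)) (*-assoc a c z))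
      c-c⁻¹ : ∀ y → c * (c⁻¹ * y) ≡ y
      c-c⁻¹ y = trans (sym (*-assoc c c⁻¹ y)) (trans (cong (_* y) cc⁻¹≡1) (*-identityˡ y))
      h-sound : ∀ j → TripleSet E (c * x) a (c * enumerate C j)
      h-sound j with enumerate-sound C j
      ... | e₁ , e₂ , e₃ = up _ e₁ , subst E (distribˡ c _ x) (up _ e₂) ,
                           subst E (trans (distribˡ c _ (a * x)) (cong (c * enumerate C j +_) (c-a x))) (up _ e₃)
      h-complete : ∀ y → TripleSet E (c * x) a y → ∃ λ j → c * enumerate C j ≡ y
      h-complete y (e₁ , e₂ , e₃) with enumerate-complete C (c⁻¹ * y) preimage
        where
        preimage : TripleSet E x a (c⁻¹ * y)
        preimage = down _ (subst E (sym (c-c⁻¹ y)) e₁) ,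
                   down _ (subst E (sym (trans (distribˡ c (c⁻¹ * y) x) (cong (_+ c * x) (c-c⁻¹ y)))) e₂) ,
                   down _ (subst E (sym (trans (distribˡ c (c⁻¹ * y) (a * x)) (cong₂ _+_ (c-c⁻¹ y) (c-a x)))) e₃)
      ... | j , ej = j , trans (cong (c *_) ej) (c-c⁻¹ y)

    module _ (a : Carrier) (σa≡a : σ a ≡ a) (x : Carrier) (σx≡x : σ x ≡ x) where

      triple-σ-stable : ∀ y → TripleSet D′ x a y → TripleSet D′ x a (σ y)
      triple-σ-stable y (d₁ , d₂ , d₃) = D′-σ-stable y d₁ ,
        subst D′ (trans (σ-+ y x) (cong (σ y +_) σx≡x)) (D′-σ-stable _ d₂) ,
        subst D′ (trans (σ-+ y (a * x)) (cong (σ y +_) (trans (σ-* a x) (cong₂ _*_ σa≡a σx≡x)))) (D′-σ-stable _ d₃)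

      triple-fixed⇒Dt : ∀ y → TripleSet D′ x a y × σ y ≡ y → TripleSet Dt x a y
      triple-fixed⇒Dt y ((d₁ , d₂ , d₃) , σy≡y) = D′-fixed⇒Dt y d₁ σy≡y ,
        D′-fixed⇒Dt _ d₂ (trans (σ-+ y x) (cong₂ _+_ σy≡y σx≡x)) ,
        D′-fixed⇒Dt _ d₃ (trans (σ-+ y (a * x)) (cong₂ _+_ σy≡y (trans (σ-* a x) (cong₂ _*_ σa≡a σx≡x))))

      Dt⇒triple-fixed : ∀ y → TripleSet Dt x a y → TripleSet D′ x a y × σ y ≡ y
      Dt⇒triple-fixed y (d₁ , d₂ , d₃) =
        (proj₁ (Dt⇒D′-fixed y d₁) , proj₁ (Dt⇒D′-fixed _ d₂) , proj₁ (Dt⇒D′-fixed _ d₃)) , proj₂ (Dt⇒D′-fixed y d₁)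

      -- Hence T_{x,a}(D′) ≡ T_{x,a}(D^(t⁻¹)) (mod t), by counting σ-orbits.
      triple-count-mod : ∀ {n₁ n₂} → Card (TripleSet Dt x a) n₁ → Card (TripleSet D′ x a) n₂ → n₂ % t ≡ n₁ % t
      triple-count-mod {n₁} {n₂} C₁ C₂ = begin
        n₂ % t             ≡⟨ cong (_% t) n₂≡n₁+tr ⟩
        (n₁ ℕ.+ t ℕ.* r) % t ≡⟨ cong (λ z → (n₁ ℕ.+ z) % t) (ℕP.*-comm t r) ⟩
        (n₁ ℕ.+ r ℕ.* t) % t ≡⟨ [m+kn]%n≡m%n n₁ r t ⟩
        n₁ % t             ∎
        where
        orbit-count : ∃ λ r → n₂ ≡ n₁ ℕ.+ t ℕ.* r
        orbit-count = PrimePeriod.card-≡-fixed-mod _≟_ index index-injective σ t t-prime σ^t≡id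
                        (TripleSet D′ x a) triple-σ-stable C₂ (card-cong Dt⇒triple-fixed triple-fixed⇒Dt C₁)
        r = proj₁ orbit-count
        n₂≡n₁+tr = proj₂ orbit-count

    -- ℓ ↦ t⁻¹ ℓ (mod N), a permutation of ℤ/N with inverse ℓ ↦ t ℓ.
    scaled : Fin N → Fin N
    scaled ℓ = fromℕ< (m%n<n (tinv ℕ.* toℕ ℓ) N)

    scaled-surjective : ∀ ℓ₁ → ∃ λ ℓ → scaled ℓ ≡ ℓ₁
    scaled-surjective ℓ₁ = ℓ , toℕ-injective (begin
        toℕ (scaled ℓ)                       ≡⟨ toℕ-fromℕ< _ ⟩
        (tinv ℕ.* toℕ ℓ) % N                 ≡⟨ cong (λ z → (tinv ℕ.* z) % N) (toℕ-fromℕ< (m%n<n (t ℕ.* toℕ ℓ₁) N)) ⟩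
        (tinv ℕ.* ((t ℕ.* toℕ ℓ₁) % N)) % N  ≡⟨ ≋-* {tinv} refl (%-≋ (t ℕ.* toℕ ℓ₁)) ⟩
        (tinv ℕ.* (t ℕ.* toℕ ℓ₁)) % N        ≡⟨ cong (_% N) (ℕP.*-assoc tinv t (toℕ ℓ₁)) ⟨
        (tinv ℕ.* t ℕ.* toℕ ℓ₁) % N          ≡⟨ ≋-* {c = toℕ ℓ₁} (trans (cong (_% N) (ℕP.*-comm tinv t)) t-tinv≋1) refl ⟩
        (1 ℕ.* toℕ ℓ₁) % N                   ≡⟨ cong (_% N) (ℕP.*-identityˡ (toℕ ℓ₁)) ⟩
        toℕ ℓ₁ % N                           ≡⟨ m<n⇒m%n≡m (toℕ<n ℓ₁) ⟩
        toℕ ℓ₁                               ∎)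
      where ℓ = fromℕ< (m%n<n (t ℕ.* toℕ ℓ₁) N)

    ω^scaled : ∀ ℓ → ∃ λ k → ω ^' toℕ (scaled ℓ) ≡ γ ^' (N ℕ.* k) * γ ^' toℕ ℓ
    ω^scaled ℓ with exponent-shift γ Q γ^Q≡1 Q≥1 N∣Q (e₀ ℕ.* toℕ (scaled ℓ)) (toℕ ℓ) exponent≋ℓ
      where
      exponent≋ℓ : e₀ ℕ.* toℕ (scaled ℓ) ≋ toℕ ℓ
      exponent≋ℓ = begin
        (e₀ ℕ.* toℕ (scaled ℓ)) % N         ≡⟨ ≋-* {e₀} refl (trans (cong (_% N) (toℕ-fromℕ< _)) (%-≋ (tinv ℕ.* toℕ ℓ))) ⟩
        (e₀ ℕ.* (tinv ℕ.* toℕ ℓ)) % N       ≡⟨ cong (_% N) (ℕP.*-assoc e₀ tinv (toℕ ℓ)) ⟨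
        (e₀ ℕ.* tinv ℕ.* toℕ ℓ) % N         ≡⟨ ≋-* {c = toℕ ℓ} e₀tinv≋1 refl ⟩
        (1 ℕ.* toℕ ℓ) % N                   ≡⟨ cong (_% N) (ℕP.*-identityˡ (toℕ ℓ)) ⟩
        toℕ ℓ % N                           ∎
    ... | k , γ^e≡ = k , (begin
      ω ^' toℕ (scaled ℓ)                 ≡⟨ ^-* γ e₀ _ ⟨
      γ ^' (e₀ ℕ.* toℕ (scaled ℓ))        ≡⟨ γ^e≡ ⟩
      γ ^' (toℕ ℓ ℕ.+ N ℕ.* k)            ≡⟨ ^-+ γ (toℕ ℓ) (N ℕ.* k) ⟩
      γ ^' toℕ ℓ * γ ^' (N ℕ.* k)         ≡⟨ *-comm _ _ ⟩
      γ ^' (N ℕ.* k) * γ ^' toℕ ℓ         ∎)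


    residue-transfer : ∀ k ℓ {n₁ n₂} →
                       Card (TripleSet Dt (ω ^' toℕ (scaled ℓ)) (ι k)) n₁ → Card (TripleSet D′ (γ ^' toℕ ℓ) (ι k)) n₂ →
                       n₂ % t ≡ n₁ % t
    residue-transfer k ℓ {n₁} {n₂} C₁ C₂ =
      triple-count-mod (ι k) (σ-ι k) x (ω^-fixed (toℕ (scaled ℓ))) C₁ C₂′
      where
      x = ω ^' toℕ (scaled ℓ)
      c = proj₁ (ω^scaled ℓ)
      N∣Nc : N ∣ N ℕ.* c
      N∣Nc = divides c (ℕP.*-comm N c)
      C₂′ : Card (TripleSet D′ x (ι k)) n₂
      C₂′ = subst (λ z → Card (TripleSet D′ z (ι k)) n₂) (sym (proj₂ (ω^scaled ℓ)))
              (triple-scale D′ (ι k) (γ ^' (N ℕ.* c)) (γ^-nonzero (N ℕ.* c))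
                (D′-scale (N ℕ.* c) N∣Nc) (D′-unscale (N ℕ.* c) N∣Nc) (γ ^' toℕ ℓ) C₂)

module DistinctValues where

  open Cardinality
  open import Defs using (#distinct)
  open import Data.Nat using (ℕ; _≟_)
  open import Data.List using (List; _∷_; lookup; deduplicate; map; allFin)
  open import Data.List.Membership.Propositional using (_∈_)
  open import Data.List.Membership.Propositional.Properties using (∈-lookup; ∈-deduplicate⁻; ∈-deduplicate⁺; ∈-map⁺; ∈-map⁻; ∈-allFin)
  open import Data.List.Relation.Unary.Any using (index)
  open import Data.List.Relation.Unary.Any.Properties using (lookup-index)
  import Data.List.Relation.Unary.All as All
  open import Data.List.Relation.Unary.AllPairs using (_∷_)
  open import Data.List.Relation.Unary.Unique.Propositional using (Unique)
  open import Data.List.Relation.Unary.Unique.DecPropositional.Properties _≟_ using (deduplicate-!)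
  open import Data.Fin using (Fin; zero; suc)
  open import Data.Product using (∃; _,_)
  open import Data.Empty using (⊥-elim)
  open import Relation.Binary.PropositionalEquality

  lookup-injective : ∀ {A : Set} {xs : List A} → Unique xs → ∀ {i j} → lookup xs i ≡ lookup xs j → i ≡ j
  lookup-injective {xs = x ∷ xs} (x∉xs ∷ u) {zero} {zero} e = refl
  lookup-injective {xs = x ∷ xs} (x∉xs ∷ u) {zero} {suc j} e = ⊥-elim (All.lookup x∉xs (∈-lookup j) e)
  lookup-injective {xs = x ∷ xs} (x∉xs ∷ u) {suc i} {zero} e = ⊥-elim (All.lookup x∉xs (∈-lookup i) (sym e))
  lookup-injective {xs = x ∷ xs} (x∉xs ∷ u) {suc i} {suc j} e = cong suc (lookup-injective u e)

  card-members : (xs : List ℕ) → Card (_∈ xs) (#distinct xs)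
  card-members xs = card (lookup (deduplicate _≟_ xs)) (lookup-injective (deduplicate-! xs))
    (λ y y∈ → index (∈-deduplicate⁺ _≟_ y∈) , sym (lookup-index (∈-deduplicate⁺ _≟_ y∈)))
    (λ j → ∈-deduplicate⁻ _≟_ xs (∈-lookup j))

  #distinct-cong : ∀ xs ys → (∀ y → y ∈ xs → y ∈ ys) → (∀ y → y ∈ ys → y ∈ xs) → #distinct xs ≡ #distinct ys
  #distinct-cong xs ys xs⊆ys ys⊆xs = card-unique′ xs⊆ys ys⊆xs (card-members xs) (card-members ys)

  values-⊆ : ∀ {n} (f g : Fin n → ℕ) → (∀ i → ∃ λ j → g i ≡ f j) →
             ∀ y → y ∈ map g (allFin n) → y ∈ map f (allFin n)
  values-⊆ {n} f g g⊆f y y∈ with ∈-map⁻ g y∈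
  ... | i , _ , refl with g⊆f i
  ... | j , gi≡fj = subst (_∈ map f (allFin n)) (sym gi≡fj) (∈-map⁺ f (∈-allFin j))

  #distinct-reindex : ∀ {n} (f g : Fin n → ℕ) (π : Fin n → Fin n) → (∀ j → ∃ λ i → π i ≡ j) →
                      (∀ i → g i ≡ f (π i)) → #distinct (map g (allFin n)) ≡ #distinct (map f (allFin n))
  #distinct-reindex {n} f g π π-surjective g≡f∘π = #distinct-cong _ _
    (values-⊆ f g λ i → π i , g≡f∘π i)
    (values-⊆ g f λ j → let (i , πi≡j) = π-surjective j in i , trans (cong f (sym πi≡j)) (sym (g≡f∘π i)))

module ExponentFacts where

  open import Defs using (IsOrd)
  open import Data.Nat using (ℕ; suc; _*_; _^_; _≤_; _%_; s≤s; z≤n; NonZero; >-nonZero)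
  open import Data.Nat.Properties using (^-*-assoc; ≤-trans; *-identityʳ; ^-monoʳ-≤; *-mono-≤)
  open import Data.Nat.DivMod using (m%n≤m)
  open import Data.Product using (proj₁; proj₂)
  open import Relation.Binary.PropositionalEquality using (_≡_; subst)

  order-power≋1 : ∀ N {{_ : NonZero N}} p f s → IsOrd N p f → (p ^ (f * s)) % N ≡ 1 % N
  order-power≋1 N p f s f-order =
    subst (λ z → z % N ≡ 1 % N) (^-*-assoc p f s) (≋-^ (mod⇒≋ (proj₁ (proj₂ f-order))) s)
    where open Congruence N using (≋-^; mod⇒≋)

  power≥3 : ∀ p f s → p % 4 ≡ 3 → 1 ≤ f → s % 2 ≡ 1 → 3 ≤ p ^ (f * s)
  power≥3 p f s p%4≡3 f≥1 s-odd = ≤-trans p≥3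
      (subst (_≤ p ^ (f * s)) (*-identityʳ p) (^-monoʳ-≤ p {{p-nonZero}} (*-mono-≤ f≥1 (odd⇒≥1 s s-odd))))
    where
    p≥3 : 3 ≤ p
    p≥3 = subst (_≤ p) p%4≡3 (m%n≤m p 4)
    p-nonZero : NonZero p
    p-nonZero = >-nonZero (≤-trans (s≤s z≤n) p≥3)
    odd⇒≥1 : ∀ x → x % 2 ≡ 1 → 1 ≤ x
    odd⇒≥1 (suc _) _ = s≤s z≤n

open import Defs
open import Data.Nat using (ℕ; _*_; _∸_; _^_; _≤_; _<_; _%_; _/_; NonZero)
open import Data.Nat.Properties using (m^n≢0; m*n≢0)
open import Data.Nat.Primality using (Prime; prime⇒nonZero)
open import Data.Nat.GCD using (gcd)
open import Data.Fin using (Fin; toℕ)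
open import Data.Fin.Subset using (Subset; _∈_)
open import Data.List using (map; allFin)
open import Data.Product using (Σ; _×_; proj₁)
open import Relation.Binary.PropositionalEquality using (_≡_; trans)
open FrobeniusLift using (module Lift)
open DistinctValues using (#distinct-reindex)
open ExponentFacts using (order-power≋1; power≥3)

theorem3p1 : (p₁ : ℕ) → Prime p₁ → p₁ % 8 ≡ 7 →
    (m : ℕ) → 1 ≤ m →
    let N = 2 * p₁ ^ m in
    (p : ℕ) → Prime p → p % 4 ≡ 3 →
    (f : ℕ) → IsOrd N p f → f ≡ φ N / 2 →
    (s : ℕ) → s % 2 ≡ 1 →
    let q = p ^ (f * s) in
    (I : Subset N) →
    (∀ (r : Fin (p₁ ^ m)) → Σ (Fin N) λ i → (i ∈ I) × (toℕ i ≡ toℕ r [mod p₁ ^ m ])) →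
    (t : ℕ) → .{{_ : NonZero t}} → Prime t → t % 2 ≡ 1 → gcd t p₁ ≡ 1 →
    (L : FiniteField) →
    FiniteField.size L ≡ q ^ t → FiniteField.ι L p ≡ FiniteField.0# L →
    (γ : FiniteField.Carrier L) → FiniteField.Primitive L γ →
    (e₀ : ℕ) → e₀ * (q ∸ 1) ≡ q ^ t ∸ 1 →
    let ω = FiniteField._^'_ L γ e₀ in
    (tinv : ℕ) → (t * tinv) ≡ 1 [mod N ] →
    (k : ℕ) → 2 ≤ k → k < p →
    let a = FiniteField.ι L k in
    (T₁ T₂ : Fin N → ℕ) →
    (∀ ℓ → FiniteField.HasCard L (FiniteField.TripleSet L (FiniteField.CosetUnion L ω N I tinv) (FiniteField._^'_ L ω (toℕ ℓ)) a) (T₁ ℓ)) →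
    (∀ ℓ → FiniteField.HasCard L (FiniteField.TripleSet L (FiniteField.CosetUnion L γ N I 1) (FiniteField._^'_ L γ (toℕ ℓ)) a) (T₂ ℓ)) →
    (u : ℕ) →
    #distinct (map (λ ℓ → T₁ ℓ % t) (allFin N)) ≡ u →
    #distinct (map (λ ℓ → T₂ ℓ % t) (allFin N)) ≡ u
theorem3p1 p₁ p₁-prime _ m _ p p-prime p%4≡3 f f-order _ s s-odd I _ t t-prime _ _ L size≡q^t ιp≡0
           γ γ-primitive e₀ e₀-def tinv t-tinv≡1 k _ _ T₁ T₂ T₁-card T₂-card u #T₁≡u =
  trans (#distinct-reindex residue₁ residue₂ scaled scaled-surjective transfer) #T₁≡u
  where
  N = 2 * p₁ ^ m
  instance
    t-nonZero : NonZero t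
    t-nonZero = prime⇒nonZero t-prime
    N-nonZero : NonZero N
    N-nonZero = m*n≢0 2 (p₁ ^ m) {{_}} {{m^n≢0 p₁ m {{prime⇒nonZero p₁-prime}}}}
  open Lift L p-prime ιp≡0 (f * s) (power≥3 p f s p%4≡3 (proj₁ f-order) s-odd) t {{t-nonZero}} t-prime
            size≡q^t γ γ-primitive e₀ e₀-def N (order-power≋1 N p f s f-order) tinv
            (Congruence.mod⇒≋ N t-tinv≡1) I
  residue₁ residue₂ : Fin N → ℕ
  residue₁ ℓ = T₁ ℓ % t
  residue₂ ℓ = T₂ ℓ % t
  transfer : ∀ ℓ → residue₂ ℓ ≡ residue₁ (scaled ℓ)
  transfer ℓ = residue-transfer k ℓ (T₁-card (scaled ℓ)) (T₂-card ℓ)
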